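{- For any QCTL formula $\Phi$ one can build an equivalent QCTL formula $\mathrm{Flat}_1(\Phi)$ of the form \[\mathcal{Q}.\Big(\Phi_0\wedge\bigwedge_{1\le i\le m}\mathsf{AG}(\kappa_i\leftrightarrow\theta_i)\Big)\] where $\mathcal{Q}$ is a sequence of propositional quantifications, $\Phi_0$ is a Boolean combination of basic CTL formulas, every $\kappa_i$ is an atomic proposition, and every $\theta_i$ ($1\le i\le m$) is a basic CTL formula; moreover $|\mathrm{Flat}_1(\Phi)|$ is in $O(|\Phi|)$.
   Context: QCTL formulas: $\varphi::= q\mid\neg\varphi\mid\varphi\vee\varphi\mid \mathsf{EX}\varphi\mid \mathsf{E}\varphi\mathsf{U}\varphi\mid\mathsf{A}\varphi\mathsf{U}\varphi\mid\exists p.\varphi$ (with $\forall p=\neg\exists p\neg$); CTL formulas are those without propositional quantifiers. Interpretation at states of finite Kripke structures (every vertex has a successor) with the usual CTL semantics and structure semantics for quantifiers ($\exists p.\varphi$ holds iff some relabelling of $p$ on the same graph, keeping other propositions, makes $\varphi$ true). $\mathsf{AG}\varphi=\neg\mathsf{E}\top\mathsf{U}\neg\varphi$. Equivalence: same truth value at every state of every Kripke structure. A CTL formula is basic if it is of the form $\mathsf{EX}\alpha$, $\mathsf{E}\alpha\mathsf{U}\beta$ or $\mathsf{A}\alpha\mathsf{U}\beta$ with $\alpha,\beta$ Boolean combinations of atomic propositions. Size: $|q|=1$; $|\neg\varphi|=|\exists p.\varphi|=|\mathsf{EX}\varphi|=1+|\varphi|$; $|\varphi\vee\psi|=|\mathsf{E}\varphi\mathsf{U}\psi|=|\mathsf{A}\varphi\mathsf{U}\psi|=1+|\varphi|+|\psi|$,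 with abbreviations expanded into primitives. -}

module Defs where

open import Data.Nat using (ℕ; zero; suc; _<_; _≡ᵇ_; _*_; _≤_; _+_)
open import Data.Fin using (Fin)
open import Data.Bool using (Bool; true; false; if_then_else_)
open import Data.List using (List; []; _∷_)
open import Data.Product using (Σ; ∃; _×_; _,_)
open import Data.Sum using (_⊎_)
open import Relation.Nullary using (¬_)
open import Relation.Binary.PropositionalEquality using (_≡_)

data Form : Set where
  atom : ℕ → Form
  neg  : Form → Form
  _∨ᶠ_ : Form → Form → Form
  EX   : Form → Form
  EU   : Form → Form → Form
  AU   : Form → Form → Form
  ∃ₚ   : ℕ → Form → Form

size : Form → ℕ
size (atom _)  = 1
size (neg φ)   = suc (size φ)
size (φ ∨ᶠ ψ)  = suc (size φ + size ψ)
size (EX φ)    = suc (size φ)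
size (EU φ ψ)  = suc (size φ + size ψ)
size (AU φ ψ)  = suc (size φ + size ψ)
size (∃ₚ _ φ)  = suc (size φ)

_∧ᶠ_ : Form → Form → Form
φ ∧ᶠ ψ = neg (neg φ ∨ᶠ neg ψ)

_⇒ᶠ_ : Form → Form → Form
φ ⇒ᶠ ψ = neg φ ∨ᶠ ψ

_⇔ᶠ_ : Form → Form → Form
φ ⇔ᶠ ψ = (φ ⇒ᶠ ψ) ∧ᶠ (ψ ⇒ᶠ φ)

⊤ᶠ : Form
⊤ᶠ = atom 0 ∨ᶠ neg (atom 0)

AG : Form → Form
AG φ = neg (EU ⊤ᶠ (neg φ))

∀ₚ : ℕ → Form → Form
∀ₚ p φ = neg (∃ₚ p (neg φ))

data IsBoolAtoms : Form → Set where
  atom : ∀ q → IsBoolAtoms (atom q)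
  neg  : ∀ {φ} → IsBoolAtoms φ → IsBoolAtoms (neg φ)
  or   : ∀ {φ ψ} → IsBoolAtoms φ → IsBoolAtoms ψ → IsBoolAtoms (φ ∨ᶠ ψ)

data IsBasic : Form → Set where
  ex : ∀ {α} → IsBoolAtoms α → IsBasic (EX α)
  eu : ∀ {α β} → IsBoolAtoms α → IsBoolAtoms β → IsBasic (EU α β)
  au : ∀ {α β} → IsBoolAtoms α → IsBoolAtoms β → IsBasic (AU α β)

data IsBoolBasic : Form → Set where
  basic : ∀ {φ} → IsBasic φ → IsBoolBasic φ
  neg   : ∀ {φ} → IsBoolBasic φ → IsBoolBasic (neg φ)
  or    : ∀ {φ ψ} → IsBoolBasic φ → IsBoolBasic ψ → IsBoolBasic (φ ∨ᶠ ψ)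

data Quant : Set where
  ∃q : ℕ → Quant
  ∀q : ℕ → Quant

quantify : List Quant → Form → Form
quantify []           φ = φ
quantify (∃q p ∷ qs)  φ = ∃ₚ p (quantify qs φ)
quantify (∀q p ∷ qs)  φ = ∀ₚ p (quantify qs φ)

conjAG : Form → List (ℕ × Form) → Form
conjAG φ₀ []             = φ₀
conjAG φ₀ ((κ , θ) ∷ cs) = conjAG φ₀ cs ∧ᶠ AG (atom κ ⇔ᶠ θ)

data AllBasic : List (ℕ × Form) → Set where
  []  : AllBasic []
  _∷_ : ∀ {κ θ cs} → IsBasic θ → AllBasic cs → AllBasic ((κ , θ) ∷ cs)

FlatForm : Form → Set
FlatForm Φ =
  Σ (List Quant) λ qs → Σ Form λ Φ₀ → Σ (List (ℕ × Form)) λ cs →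
    (Φ ≡ quantify qs (conjAG Φ₀ cs)) × IsBoolBasic Φ₀ × AllBasic cs

record Graph : Set where
  field
    n      : ℕ
    R      : Fin n → Fin n → Bool
    serial : ∀ s → ∃ λ t → R s t ≡ true

Labelling : ℕ → Set
Labelling n = ℕ → Fin n → Bool

record Kripke : Set where
  field
    graph : Graph
    L     : Labelling (Graph.n graph)
  open Graph graph public

relabel : ∀ {n} → Labelling n → ℕ → (Fin n → Bool) → Labelling n
relabel L p f q = if q ≡ᵇ p then f else L q

module _ (G : Graph) where
  open Graph G

  record Path (s : Fin n) : Set where
    field
      π     : ℕ → Fin n
      start : π 0 ≡ s
      step  : ∀ i → R (π i) (π (suc i)) ≡ true
  open Path

  Sat : Labelling n → Form → Fin n → Set
  Sat L (atom q) s = L q s ≡ true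
  Sat L (neg φ)  s = ¬ Sat L φ s
  Sat L (φ ∨ᶠ ψ) s = Sat L φ s ⊎ Sat L ψ s
  Sat L (EX φ)   s = ∃ λ t → (R s t ≡ true) × Sat L φ t
  Sat L (EU φ ψ) s = Σ (Path s) λ ρ → ∃ λ k →
    Sat L ψ (π ρ k) × (∀ j → j < k → Sat L φ (π ρ j))
  Sat L (AU φ ψ) s = (ρ : Path s) → ∃ λ k →
    Sat L ψ (π ρ k) × (∀ j → j < k → Sat L φ (π ρ j))
  Sat L (∃ₚ p φ) s = ∃ λ (f : Fin n → Bool) → Sat (relabel L p f) φ s

_,_⊨_ : (K : Kripke) → Fin (Kripke.n K) → Form → Set
K , s ⊨ φ = Sat (Kripke.graph K) (Kripke.L K) φ s

_≣_ : Form → Form → Set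
φ ≣ ψ = ∀ (K : Kripke) (s : Fin (Kripke.n K)) →
  ((K , s ⊨ φ) → (K , s ⊨ ψ)) × ((K , s ⊨ ψ) → (K , s ⊨ φ))

-- Give every subformula ψ of Φ a fresh atom κ constrained from one side only: AG (κ → ψ′) in positive
-- position, AG (ψ′ → κ) in negative position, where ψ′ is ψ with its immediate subformulas replaced by
-- their atoms; a temporal operator gets one more atom c with AG (c ↔ EX a), AG (c ↔ E a U b) or
-- AG (c ↔ A a U b). All constraints are then Boolean combinations of basic formulas, and the fresh atoms
-- are quantified in front. As every connective but negation (which flips the side) is monotone, these
-- one-sided constraints compose; conversely, labelling each fresh atom by the truth value of its
-- subformula satisfies them. ∃p. φ in negative position becomes a ∀ in front; in positive position a
-- universally quantified marker atom singles out one reachable state at a time, so that the witness for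
-- p may depend on that state. Each subformula contributes boundedly many symbols, hence linear size.
-- Truth values exist since satisfaction in a finite structure is decidable (least fixed points for the
-- until operators), which also licenses the classical reasoning throughout.

module Submission where

open import Defs
open import Data.Nat using (ℕ; zero; suc; _+_; _*_; _⊔_; _<_; _≤_; _≡ᵇ_; z≤n; s≤s)
open import Data.Nat using (_≤′_; ≤′-refl; ≤′-step)
open import Data.Nat.GeneralisedArithmetic using (fold)
import Data.Nat.Properties as ℕ
open import Data.Nat.Tactic.RingSolver using (solve-∀)
open import Data.Fin using (Fin; toℕ; zero; suc)
import Data.Fin as Fin
open import Data.Fin.Properties using (any?; all?; toℕ<n)
open import Data.Fin.Subset using (Subset; _∈_; _∉_; _⊆_; _⊂_; ∣_∣) renaming (⊥ to ∅)
open import Data.Fin.Subset.Properties using (_∈?_; _⊂?_; ⊥⊆; ∉⊥; p⊂q⇒∣p∣<∣q∣; ∣p∣≤n; anySubset?)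
open import Data.Vec using (Vec; []; _∷_; tabulate; lookup)
open import Data.Vec.Properties using (lookup∘tabulate; []=⇒lookup; lookup⇒[]=)
open import Data.List using (List; []; _∷_; _++_)
open import Data.List.Relation.Unary.All as All using (All; []; _∷_)
open import Data.List.Relation.Unary.All.Properties using (++⁺; ++⁻)
open import Data.Bool using (Bool; true; false; if_then_else_)
open import Data.Bool.Properties using (_≟_)
open import Data.Product using (Σ; ∃; _×_; _,_; proj₁; proj₂; swap)
open import Data.Product.Function.NonDependent.Propositional using (_×-⇔_)
import Data.Sum
open import Data.Sum using (_⊎_; inj₁; inj₂; map₂)
open import Data.Unit using (⊤; tt)
open import Data.Empty using (⊥; ⊥-elim)
open import Function using (_∘_; _⇔_; mk⇔; Equivalence)
open import Function.Construct.Composition using (_⇔-∘_)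
open import Function.Construct.Symmetry using (⇔-sym)
open import Function.Construct.Identity using (⇔-id)
open import Relation.Binary.PropositionalEquality using (_≡_; _≢_; refl; sym; trans; subst; cong)
open import Relation.Binary.Construct.Closure.ReflexiveTransitive using (Star; ε; _◅_; _◅◅_)
open import Relation.Nullary using (¬_; Dec; yes; no; does; contradiction)
open import Relation.Nullary.Decidable using (map′; _×-dec_; _⊎-dec_; _→-dec_; ¬?)
open import Relation.Nullary.Decidable using (dec-true; dec-false; decidable-stable)
open import Relation.Unary using (Pred; Decidable; _∪_)
open import Level using (0ℓ)

open Equivalence using (to; from)

-- Atoms, relabellings and fresh atoms

data AllAtoms (P : ℕ → Set) : Form → Set where
  atom : ∀ {q} → P q → AllAtoms P (atom q)
  neg  : ∀ {φ} → AllAtoms P φ → AllAtoms P (neg φ)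
  _∨ᶠ_ : ∀ {φ ψ} → AllAtoms P φ → AllAtoms P ψ → AllAtoms P (φ ∨ᶠ ψ)
  EX   : ∀ {φ} → AllAtoms P φ → AllAtoms P (EX φ)
  EU   : ∀ {φ ψ} → AllAtoms P φ → AllAtoms P ψ → AllAtoms P (EU φ ψ)
  AU   : ∀ {φ ψ} → AllAtoms P φ → AllAtoms P ψ → AllAtoms P (AU φ ψ)
  ∃ₚ   : ∀ {p φ} → P p → AllAtoms P φ → AllAtoms P (∃ₚ p φ)

allAtoms-⊤ : ∀ φ → AllAtoms (λ _ → ⊤) φ
allAtoms-⊤ (atom q) = atom tt
allAtoms-⊤ (neg φ) = neg (allAtoms-⊤ φ)
allAtoms-⊤ (φ ∨ᶠ ψ) = allAtoms-⊤ φ ∨ᶠ allAtoms-⊤ ψ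
allAtoms-⊤ (EX φ) = EX (allAtoms-⊤ φ)
allAtoms-⊤ (EU φ ψ) = EU (allAtoms-⊤ φ) (allAtoms-⊤ ψ)
allAtoms-⊤ (AU φ ψ) = AU (allAtoms-⊤ φ) (allAtoms-⊤ ψ)
allAtoms-⊤ (∃ₚ p φ) = ∃ₚ tt (allAtoms-⊤ φ)

allAtoms-mono : ∀ {P P′ : ℕ → Set} → (∀ {a} → P a → P′ a) → ∀ {φ} → AllAtoms P φ → AllAtoms P′ φ
allAtoms-mono P⊆P′ (atom h) = atom (P⊆P′ h)
allAtoms-mono P⊆P′ (neg h) = neg (allAtoms-mono P⊆P′ h)
allAtoms-mono P⊆P′ (h ∨ᶠ h′) = allAtoms-mono P⊆P′ h ∨ᶠ allAtoms-mono P⊆P′ h′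
allAtoms-mono P⊆P′ (EX h) = EX (allAtoms-mono P⊆P′ h)
allAtoms-mono P⊆P′ (EU h h′) = EU (allAtoms-mono P⊆P′ h) (allAtoms-mono P⊆P′ h′)
allAtoms-mono P⊆P′ (AU h h′) = AU (allAtoms-mono P⊆P′ h) (allAtoms-mono P⊆P′ h′)
allAtoms-mono P⊆P′ (∃ₚ hp h) = ∃ₚ (P⊆P′ hp) (allAtoms-mono P⊆P′ h)

Agree : ∀ {m} → (ℕ → Set) → Labelling m → Labelling m → Set
Agree P L L′ = ∀ a → P a → ∀ t → L a t ≡ L′ a t

agree-sym : ∀ {m P} {L L′ : Labelling m} → Agree P L L′ → Agree P L′ L
agree-sym L≈L′ a pa t = sym (L≈L′ a pa t)

agree-relabel : ∀ {m P} {L L′ : Labelling m} p f g → Agree P L L′ → (∀ t → f t ≡ g t) →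
                Agree P (relabel L p f) (relabel L′ p g)
agree-relabel p f g L≈L′ f≗g a pa t with a ≡ᵇ p
... | true = f≗g t
... | false = L≈L′ a pa t

relabel-same : ∀ {m} (L : Labelling m) p f t → relabel L p f p t ≡ f t
relabel-same L p f t rewrite dec-true (p ℕ.≟ p) refl = refl

relabel-other : ∀ {m} (L : Labelling m) {p a} f t → a ≢ p → relabel L p f a t ≡ L a t
relabel-other L {p} {a} f t a≢p rewrite dec-false (a ℕ.≟ p) a≢p = refl

extend : ∀ {m k} → Labelling m → ℕ → Vec (Fin m → Bool) k → Labelling m
extend L v [] = L
extend L v (f ∷ fs) = extend (relabel L v f) (suc v) fs

extend-below : ∀ {m k} (L : Labelling m) {v a} (fs : Vec _ k) t → a < v → extend L v fs a t ≡ L a t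
extend-below L [] t a<v = refl
extend-below L (f ∷ fs) t a<v = trans (extend-below _ fs t (ℕ.m<n⇒m<1+n a<v)) (relabel-other L f t (ℕ.<⇒≢ a<v))

extend-lookup : ∀ {m k} (L : Labelling m) v (fs : Vec _ k) i t → extend L v fs (toℕ i + v) t ≡ lookup fs i t
extend-lookup L v (f ∷ fs) zero t = trans (extend-below _ fs t (ℕ.n<1+n v)) (relabel-same L v f t)
extend-lookup L v (f ∷ fs) (suc i) t =
  subst (λ a → extend (relabel L v f) (suc v) fs a t ≡ lookup fs i t) (ℕ.+-suc (toℕ i) v)
        (extend-lookup _ (suc v) fs i t)

fresh∃ : ℕ → ℕ → List Quant
fresh∃ v zero = []
fresh∃ v (suc k) = ∃q v ∷ fresh∃ (suc v) k

bound : Quant → ℕ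
bound (∃q p) = p
bound (∀q p) = p

AllBound : (ℕ → Set) → List Quant → Set
AllBound P = All (P ∘ bound)

Disjoint : (ℕ → Set) → (ℕ → Set) → Set
Disjoint P V = ∀ a → P a → V a → ⊥

quantify-++ : ∀ Q₁ Q₂ X → quantify (Q₁ ++ Q₂) X ≡ quantify Q₁ (quantify Q₂ X)
quantify-++ [] Q₂ X = refl
quantify-++ (∃q p ∷ Q₁) Q₂ X = cong (∃ₚ p) (quantify-++ Q₁ Q₂ X)
quantify-++ (∀q p ∷ Q₁) Q₂ X = cong (∀ₚ p) (quantify-++ Q₁ Q₂ X)

-- Paths, and deciding satisfaction

module Paths (G : Graph) where
  open Graph G
  open Path

  Edge : Fin n → Fin n → Set
  Edge s t = R s t ≡ true

  Reach : Fin n → Fin n → Set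
  Reach = Star Edge

  State : Set₁
  State = Pred (Fin n) 0ℓ

  Marking : Set
  Marking = Fin n → Bool

  cons : ∀ {s t} → Edge s t → Path G t → Path G s
  cons {s} e ρ = record { π = λ { zero → s ; (suc i) → π ρ i } ; start = refl ; step = step′ }
    where
    step′ : ∀ i → _
    step′ zero = subst (Edge s) (sym (start ρ)) e
    step′ (suc i) = step ρ i

  first-edge : ∀ {s} (ρ : Path G s) → Edge s (π ρ 1)
  first-edge ρ = subst (λ s → Edge s (π ρ 1)) (start ρ) (step ρ 0)

  tail : ∀ {s} (ρ : Path G s) → Path G (π ρ 1)
  tail ρ = record { π = λ i → π ρ (suc i) ; start = refl ; step = λ i → step ρ (suc i) }

  following : (next : Fin n → Fin n) → (∀ t → Edge t (next t)) → ∀ s → Path G s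
  following next edge s = record { π = fold s next ; start = refl ; step = λ i → edge (fold s next i) }

  some-path : ∀ s → Path G s
  some-path = following (λ t → proj₁ (serial t)) (λ t → proj₂ (serial t))

  reach-π : ∀ {s} (ρ : Path G s) k → Reach s (π ρ k)
  reach-π ρ zero = subst (λ t → Reach t (π ρ 0)) (start ρ) ε
  reach-π ρ (suc k) = reach-π ρ k ◅◅ (step ρ k ◅ ε)

  path-through : ∀ {s t} → Reach s t → Σ (Path G s) λ ρ → ∃ λ k → π ρ k ≡ t
  path-through {s} ε = some-path s , 0 , refl
  path-through (e ◅ r) with path-through r
  ... | ρ , k , ρk≡t = cons e ρ , suc k , ρk≡t

  EXₚ : State → State
  EXₚ P s = ∃ λ t → Edge s t × P t

  EUₚ AUₚ : State → State → State
  EUₚ P Q s = Σ (Path G s) λ ρ → ∃ λ k → Q (π ρ k) × (∀ j → j < k → P (π ρ j))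
  AUₚ P Q s = (ρ : Path G s) → ∃ λ k → Q (π ρ k) × (∀ j → j < k → P (π ρ j))

  _⊆⟨_⟩_ : State → Fin n → State → Set
  P ⊆⟨ s ⟩ Q = ∀ t → Reach s t → P t → Q t

  Monotone₁ : (State → State) → Set₁
  Monotone₁ Op = ∀ {s P P′} → P ⊆⟨ s ⟩ P′ → Op P ⊆⟨ s ⟩ Op P′

  Monotone₂ : (State → State → State) → Set₁
  Monotone₂ Op = ∀ {s P P′ Q Q′} → P ⊆⟨ s ⟩ P′ → Q ⊆⟨ s ⟩ Q′ → Op P Q ⊆⟨ s ⟩ Op P′ Q′

  ∪-mono : Monotone₂ _∪_
  ∪-mono P⊆P′ Q⊆Q′ t r = Data.Sum.map (P⊆P′ t r) (Q⊆Q′ t r)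

  EXₚ-mono : Monotone₁ EXₚ
  EXₚ-mono P⊆P′ _ r (t , e , p) = t , e , P⊆P′ t (r ◅◅ (e ◅ ε)) p

  EUₚ-mono : Monotone₂ EUₚ
  EUₚ-mono P⊆P′ Q⊆Q′ _ r (ρ , k , q , ps) =
    ρ , k , Q⊆Q′ _ (r ◅◅ reach-π ρ k) q , λ j j<k → P⊆P′ _ (r ◅◅ reach-π ρ j) (ps j j<k)

  AUₚ-mono : Monotone₂ AUₚ
  AUₚ-mono P⊆P′ Q⊆Q′ _ r h ρ with h ρ
  ... | k , q , ps = k , Q⊆Q′ _ (r ◅◅ reach-π ρ k) q , λ j j<k → P⊆P′ _ (r ◅◅ reach-π ρ j) (ps j j<k)

module LeastFixedPoint {m} (F : Subset m → Subset m) (F-mono : ∀ {p q} → p ⊆ q → F p ⊆ F q) where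

  approx : ℕ → Subset m
  approx = fold ∅ F

  lfp : Subset m
  lfp = approx m

  approx-⊆-suc : ∀ k → approx k ⊆ approx (suc k)
  approx-⊆-suc zero = ⊥⊆
  approx-⊆-suc (suc k) = F-mono (approx-⊆-suc k)

  approx-mono : ∀ {k l} → k ≤′ l → approx k ⊆ approx l
  approx-mono ≤′-refl x∈ = x∈
  approx-mono {l = suc l} (≤′-step k≤l) x∈ = approx-⊆-suc l (approx-mono k≤l x∈)

  Stable : ℕ → Set
  Stable k = approx (suc k) ⊆ approx k

  stable-bounds-all : ∀ k → Stable k → ∀ l → approx l ⊆ approx k
  stable-bounds-all k stable zero = ⊥⊆
  stable-bounds-all k stable (suc l) x∈ = stable (F-mono (stable-bounds-all k stable l) x∈)

  stable-or-grows : ∀ k → Stable k ⊎ approx k ⊂ approx (suc k)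
  stable-or-grows k with approx k ⊂? approx (suc k)
  ... | yes grows = inj₂ grows
  ... | no ¬grows = inj₁ stable
    where
    stable : Stable k
    stable {x} x∈ with x ∈? approx k
    ... | yes x∈′ = x∈′
    ... | no x∉ = contradiction ((λ {y} → approx-⊆-suc k {y}) , x , x∈ , x∉) ¬grows

  -- Each strict step adds an element, so a chain of m + 1 strict steps is impossible.
  stabilises : ∀ i → (∃ λ k → k < i × Stable k) ⊎ i ≤ ∣ approx i ∣
  stabilises zero = inj₂ z≤n
  stabilises (suc i) with stabilises i
  ... | inj₁ (k , k<i , stable) = inj₁ (k , ℕ.m<n⇒m<1+n k<i , stable)
  ... | inj₂ i≤∣approx∣ with stable-or-grows i
  ...   | inj₁ stable = inj₁ (i , ℕ.n<1+n i , stable)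
  ...   | inj₂ grows = inj₂ (ℕ.≤-<-trans i≤∣approx∣ (p⊂q⇒∣p∣<∣q∣ grows))

  approx-⊆-lfp : ∀ l → approx l ⊆ lfp
  approx-⊆-lfp l with stabilises (suc m)
  ... | inj₂ m<∣approx∣ = contradiction (ℕ.≤-trans m<∣approx∣ (∣p∣≤n (approx (suc m)))) (ℕ.n≮n m)
  ... | inj₁ (k , s≤s k≤m , stable) = λ x∈ → approx-mono (ℕ.≤⇒≤′ k≤m) (stable-bounds-all k stable l x∈)

  lfp-closed : F lfp ⊆ lfp
  lfp-closed = approx-⊆-lfp (suc m)

does-true : ∀ {A : Set} (a? : Dec A) → does a? ≡ true → A
does-true (yes a) _ = a

module _ {m} {P : Pred (Fin m) 0ℓ} (P? : Decidable P) where

  subset : Subset m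
  subset = tabulate (λ t → does (P? t))

  ∈-subset : ∀ {t} → t ∈ subset ⇔ P t
  ∈-subset {t} = mk⇔ (λ t∈ → does-true (P? t) (trans (sym (lookup∘tabulate _ t)) ([]=⇒lookup t∈)))
                  (λ p → lookup⇒[]= t subset (trans (lookup∘tabulate _ t) (dec-true (P? t) p)))

module Until (G : Graph) {P Q : Pred (Fin (Graph.n G)) 0ℓ} (P? : Decidable P) (Q? : Decidable Q) where
  open Graph G
  open Paths G
  open Path

  edge? : ∀ s t → Dec (Edge s t)
  edge? s t = R s t ≟ true

  EU-pre AU-pre : Subset n → State
  EU-pre X t = Q t ⊎ (P t × EXₚ (_∈ X) t)
  AU-pre X t = Q t ⊎ (P t × (∀ t′ → Edge t t′ → t′ ∈ X))

  EU-pre? : ∀ X → Decidable (EU-pre X)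
  EU-pre? X t = Q? t ⊎-dec (P? t ×-dec any? λ t′ → edge? t t′ ×-dec (t′ ∈? X))

  AU-pre? : ∀ X → Decidable (AU-pre X)
  AU-pre? X t = Q? t ⊎-dec (P? t ×-dec all? λ t′ → edge? t t′ →-dec (t′ ∈? X))

  EU-step AU-step : Subset n → Subset n
  EU-step X = subset (EU-pre? X)
  AU-step X = subset (AU-pre? X)

  ∈EU-step : ∀ {X t} → t ∈ EU-step X ⇔ EU-pre X t
  ∈EU-step {X} = ∈-subset (EU-pre? X)

  ∈AU-step : ∀ {X t} → t ∈ AU-step X ⇔ AU-pre X t
  ∈AU-step {X} = ∈-subset (AU-pre? X)

  EU-step-mono : ∀ {X Y} → X ⊆ Y → EU-step X ⊆ EU-step Y
  EU-step-mono X⊆Y t∈ with to ∈EU-step t∈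
  ... | inj₁ q = from ∈EU-step (inj₁ q)
  ... | inj₂ (p , t′ , e , t′∈X) = from ∈EU-step (inj₂ (p , t′ , e , X⊆Y t′∈X))

  AU-step-mono : ∀ {X Y} → X ⊆ Y → AU-step X ⊆ AU-step Y
  AU-step-mono X⊆Y t∈ with to ∈AU-step t∈
  ... | inj₁ q = from ∈AU-step (inj₁ q)
  ... | inj₂ (p , succ∈X) = from ∈AU-step (inj₂ (p , λ t′ e → X⊆Y (succ∈X t′ e)))

  module E = LeastFixedPoint EU-step EU-step-mono
  module A = LeastFixedPoint AU-step AU-step-mono

  EU-sound : ∀ k {s} → s ∈ E.approx k → EUₚ P Q s
  EU-sound zero s∈ = contradiction s∈ ∉⊥
  EU-sound (suc k) {s} s∈ with to ∈EU-step s∈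
  ... | inj₁ q = some-path s , 0 , q , λ _ ()
  ... | inj₂ (p , t , e , t∈) with EU-sound k t∈
  ...   | ρ , k′ , q , ps = cons e ρ , suc k′ , q , λ { zero _ → p ; (suc j) (s≤s j<k′) → ps j j<k′ }

  EU-complete : ∀ k {s} (ρ : Path G s) → Q (π ρ k) → (∀ j → j < k → P (π ρ j)) → s ∈ E.approx (suc k)
  EU-complete zero ρ q _ = from ∈EU-step (inj₁ (subst Q (start ρ) q))
  EU-complete (suc k) ρ q ps =
    from ∈EU-step (inj₂ (subst P (start ρ) (ps 0 (s≤s z≤n)) , π ρ 1 , first-edge ρ ,
                         EU-complete k (tail ρ) q (λ j j<k → ps (suc j) (s≤s j<k))))

  EU? : ∀ s → Dec (EUₚ P Q s)
  EU? s = map′ (EU-sound n) (λ { (ρ , k , q , ps) → E.approx-⊆-lfp (suc k) (EU-complete k ρ q ps) }) (s ∈? E.lfp)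

  AU-sound : ∀ k {s} → s ∈ A.approx k → AUₚ P Q s
  AU-sound zero s∈ = contradiction s∈ ∉⊥
  AU-sound (suc k) {s} s∈ ρ with to ∈AU-step s∈
  ... | inj₁ q = 0 , subst Q (sym (start ρ)) q , λ _ ()
  ... | inj₂ (p , succ∈) with AU-sound k (succ∈ (π ρ 1) (first-edge ρ)) (tail ρ)
  ...   | k′ , q , ps = suc k′ , q , λ { zero _ → subst P (sym (start ρ)) p ; (suc j) (s≤s j<k′) → ps j j<k′ }

  -- Outside the least fixed point, a P-state always has a successor outside it.
  escape : ∀ t → ∃ λ t′ → Edge t t′ × (t ∉ A.lfp → P t → t′ ∉ A.lfp)
  escape t with any? (λ t′ → edge? t t′ ×-dec ¬? (t′ ∈? A.lfp))
  ... | yes (t′ , e , t′∉) = t′ , e , λ _ _ → t′∉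
  ... | no ∄ = proj₁ (serial t) , proj₂ (serial t) ,
               λ t∉ p → contradiction (A.lfp-closed (from ∈AU-step (inj₂ (p , succ∈)))) t∉
    where
    succ∈ : ∀ t′ → Edge t t′ → t′ ∈ A.lfp
    succ∈ t′ e with t′ ∈? A.lfp
    ... | yes t′∈ = t′∈
    ... | no t′∉ = contradiction (t′ , e , t′∉) ∄

  escape-path : ∀ s → Path G s
  escape-path = following (λ t → proj₁ (escape t)) (λ t → proj₁ (proj₂ (escape t)))

  escape-path-outside : ∀ {s} → s ∉ A.lfp → ∀ k → (∀ j → j < k → P (π (escape-path s) j)) →
                        π (escape-path s) k ∉ A.lfp
  escape-path-outside s∉ zero _ = s∉
  escape-path-outside s∉ (suc k) ps =
    proj₂ (proj₂ (escape _)) (escape-path-outside s∉ k (λ j j<k → ps j (ℕ.m<n⇒m<1+n j<k))) (ps k ℕ.≤-refl)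

  AU-complete : ∀ {s} → s ∉ A.lfp → ¬ AUₚ P Q s
  AU-complete {s} s∉ h with h (escape-path s)
  ... | k , q , ps = escape-path-outside s∉ k ps (A.lfp-closed (from ∈AU-step (inj₁ q)))

  AU? : ∀ s → Dec (AUₚ P Q s)
  AU? s with s ∈? A.lfp
  ... | yes s∈ = yes (AU-sound n s∈)
  ... | no s∉ = no (AU-complete s∉)

module Semantics (G : Graph) where
  open Graph G
  open Paths G public
  open Path

  Lab : Set
  Lab = Labelling n

  sat-local : ∀ {P} {L L′ : Lab} {φ} → AllAtoms P φ → Agree P L L′ → ∀ s → Sat G L φ s → Sat G L′ φ s
  sat-local {φ = atom q} (atom pq) L≈L′ s h = trans (sym (L≈L′ q pq s)) h
  sat-local (neg hφ) L≈L′ s h h′ = h (sat-local hφ (agree-sym L≈L′) s h′)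
  sat-local (hφ ∨ᶠ hψ) L≈L′ s (inj₁ h) = inj₁ (sat-local hφ L≈L′ s h)
  sat-local (hφ ∨ᶠ hψ) L≈L′ s (inj₂ h) = inj₂ (sat-local hψ L≈L′ s h)
  sat-local (EX hφ) L≈L′ s = EXₚ-mono (λ t _ → sat-local hφ L≈L′ t) s ε
  sat-local (EU hφ hψ) L≈L′ s = EUₚ-mono (λ t _ → sat-local hφ L≈L′ t) (λ t _ → sat-local hψ L≈L′ t) s ε
  sat-local (AU hφ hψ) L≈L′ s = AUₚ-mono (λ t _ → sat-local hφ L≈L′ t) (λ t _ → sat-local hψ L≈L′ t) s ε
  sat-local {φ = ∃ₚ p φ} (∃ₚ _ hφ) L≈L′ s (f , h) =
    f , sat-local hφ (agree-relabel p f f L≈L′ λ _ → refl) s h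

  sat? : ∀ L φ s → Dec (Sat G L φ s)
  sat? L (atom q) s = L q s ≟ true
  sat? L (neg φ) s = ¬? (sat? L φ s)
  sat? L (φ ∨ᶠ ψ) s = sat? L φ s ⊎-dec sat? L ψ s
  sat? L (EX φ) s = any? λ t → (R s t ≟ true) ×-dec sat? L φ t
  sat? L (EU φ ψ) s = Until.EU? G (sat? L φ) (sat? L ψ) s
  sat? L (AU φ ψ) s = Until.AU? G (sat? L φ) (sat? L ψ) s
  sat? L (∃ₚ p φ) s =
    map′ (λ (X , h) → lookup X , h)
         (λ (f , h) → tabulate f , sat-local (allAtoms-⊤ φ)
                                     (agree-relabel {L = L} p f _ (λ _ _ _ → refl) λ t → sym (lookup∘tabulate f t)) s h)
         (anySubset? λ X → sat? (relabel L p (lookup X)) φ s)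

  does-sat : ∀ L φ t → does (sat? L φ t) ≡ true ⇔ Sat G L φ t
  does-sat L φ t = mk⇔ (does-true (sat? L φ t)) (dec-true (sat? L φ t))

  truth : Lab → Form → Fin n → Bool
  truth L φ t = does (sat? L φ t)

  dne : ∀ L φ t → ¬ ¬ Sat G L φ t → Sat G L φ t
  dne L φ t = decidable-stable (sat? L φ t)

  sat-⊤ : ∀ L t → Sat G L ⊤ᶠ t
  sat-⊤ L t with L 0 t ≟ true
  ... | yes l = inj₁ l
  ... | no ¬l = inj₂ ¬l

  sat-∧ : ∀ {L} φ ψ {t} → Sat G L (φ ∧ᶠ ψ) t ⇔ (Sat G L φ t × Sat G L ψ t)
  sat-∧ {L} φ ψ {t} = mk⇔ (λ h → dne L φ t (λ ¬φ → h (inj₁ ¬φ)) , dne L ψ t (λ ¬ψ → h (inj₂ ¬ψ)))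
                          (λ { (hφ , hψ) (inj₁ ¬φ) → ¬φ hφ ; (hφ , hψ) (inj₂ ¬ψ) → ¬ψ hψ })

  sat-⇒ : ∀ {L} φ ψ {t} → Sat G L (φ ⇒ᶠ ψ) t ⇔ (Sat G L φ t → Sat G L ψ t)
  sat-⇒ {L} φ ψ {t} = mk⇔ (λ { (inj₁ ¬φ) h → contradiction h ¬φ ; (inj₂ hψ) _ → hψ }) to′
    where
    to′ : (Sat G L φ t → Sat G L ψ t) → Sat G L (φ ⇒ᶠ ψ) t
    to′ h with sat? L φ t
    ... | yes hφ = inj₂ (h hφ)
    ... | no ¬φ = inj₁ ¬φ

  sat-⇔ : ∀ {L} φ ψ {t} → Sat G L (φ ⇔ᶠ ψ) t ⇔ (Sat G L φ t ⇔ Sat G L ψ t)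
  sat-⇔ φ ψ = mk⇔ (λ h → let (φ⇒ψ , ψ⇒φ) = to both h
                         in mk⇔ (to (sat-⇒ φ ψ) φ⇒ψ) (to (sat-⇒ ψ φ) ψ⇒φ))
                  (λ e → from both (from (sat-⇒ φ ψ) (to e) , from (sat-⇒ ψ φ) (from e)))
    where both = sat-∧ (φ ⇒ᶠ ψ) (ψ ⇒ᶠ φ)

  sat-EF : ∀ {L} φ {s} → Sat G L (EU ⊤ᶠ φ) s ⇔ (∃ λ t → Reach s t × Sat G L φ t)
  sat-EF {L} φ = mk⇔ (λ (ρ , k , h , _) → Path.π ρ k , reach-π ρ k , h)
                     (λ (t , r , h) → let (ρ , k , ρk≡t) = path-through r
                                      in ρ , k , subst (Sat G L φ) (sym ρk≡t) h , λ j _ → sat-⊤ L (Path.π ρ j))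

  sat-AG : ∀ {L} φ {s} → Sat G L (AG φ) s ⇔ (∀ t → Reach s t → Sat G L φ t)
  sat-AG {L} φ = mk⇔ (λ h t r → dne L φ t λ ¬φ → h (from (sat-EF (neg φ)) (t , r , ¬φ)))
                     (λ h ef → let (t , r , ¬φ) = to (sat-EF (neg φ)) ef in ¬φ (h t r))

  sat-now : ∀ {L} φ {s} → Sat G L (EU (neg ⊤ᶠ) φ) s ⇔ Sat G L φ s
  sat-now {L} φ {s} = mk⇔ (λ { (ρ , zero , h , _) → subst (Sat G L φ) (Path.start ρ) h
                             ; (ρ , suc k , _ , ps) → ⊥-elim (ps 0 (s≤s z≤n) (sat-⊤ L _)) })
                          (λ h → some-path s , 0 , h , λ _ ())

  sat-∀ₚ : ∀ {L} p φ {s} → Sat G L (∀ₚ p φ) s ⇔ (∀ f → Sat G (relabel L p f) φ s)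
  sat-∀ₚ {L} p φ {s} = mk⇔ (λ h f → dne (relabel L p f) φ s λ ¬φ → h (f , ¬φ))
                           (λ h (f , ¬φ) → ¬φ (h f))

  DefsHold : Lab → List (ℕ × Form) → Fin n → Set
  DefsHold L D s = All (λ (κ , θ) → Sat G L (AG (atom κ ⇔ᶠ θ)) s) D

  sat-conjAG : ∀ {L} C D {s} → Sat G L (conjAG C D) s ⇔ (Sat G L C s × DefsHold L D s)
  sat-conjAG C [] = mk⇔ (λ h → h , []) proj₁
  sat-conjAG C ((κ , θ) ∷ D) =
    mk⇔ (λ h → let (h₁ , d) = to split h ; (c , ds) = to (sat-conjAG C D) h₁ in c , d ∷ ds)
        (λ { (c , d ∷ ds) → from split (from (sat-conjAG C D) (c , ds) , d) })
    where split = sat-∧ (conjAG C D) (AG (atom κ ⇔ᶠ θ))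

  sat-conjAG-∧ : ∀ {L} X C ds D {s} →
                 Sat G L (conjAG (X ∧ᶠ C) (ds ++ D)) s ⇔ Sat G L (conjAG X ds ∧ᶠ conjAG C D) s
  sat-conjAG-∧ X C ds D =
    mk⇔ (λ h → let (xc , dD) = to whole h ; (x , c) = to (sat-∧ X C) xc ; (d₁ , d₂) = ++⁻ ds dD
               in from halves (from (sat-conjAG X ds) (x , d₁) , from (sat-conjAG C D) (c , d₂)))
        (λ h → let (xd , cd) = to halves h ; (x , d₁) = to (sat-conjAG X ds) xd ; (c , d₂) = to (sat-conjAG C D) cd
               in from whole (from (sat-∧ X C) (x , c) , ++⁺ d₁ d₂))
    where
    whole = sat-conjAG (X ∧ᶠ C) (ds ++ D)
    halves = sat-∧ (conjAG X ds) (conjAG C D)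

  quantify-cong : ∀ {X Y s} → (∀ L → Sat G L X s ⇔ Sat G L Y s) → ∀ Q L →
                  Sat G L (quantify Q X) s ⇔ Sat G L (quantify Q Y) s
  quantify-cong X⇔Y [] L = X⇔Y L
  quantify-cong X⇔Y (∃q p ∷ Q) L = mk⇔ (λ (f , h) → f , to (IH f) h) (λ (f , h) → f , from (IH f) h)
    where IH = λ f → quantify-cong X⇔Y Q (relabel L p f)
  quantify-cong X⇔Y (∀q p ∷ Q) L =
    mk⇔ (λ h (f , ¬Y) → h (f , ¬Y ∘ to (IH f))) (λ h (f , ¬X) → h (f , ¬X ∘ from (IH f)))
    where IH = λ f → quantify-cong X⇔Y Q (relabel L p f)

-- The translation

data Polarity : Set where
  positive negative : Polarity

opposite : Polarity → Polarity
opposite positive = negative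
opposite negative = positive

guard : Polarity → Form → Form → Form
guard positive A B = A ⇒ᶠ B
guard negative A B = B ⇒ᶠ A

EF : Form → Form
EF = EU ⊤ᶠ

record Output : Set where
  constructor output
  field
    prefix : List Quant
    base   : Form
    defs   : List (ℕ × Form)
    next   : ℕ
open Output

formula : Output → Form
formula o = quantify (prefix o) (conjAG (base o) (defs o))

node : List Quant → Form → List (ℕ × Form) → Output → Output
node vs X ds o = output (vs ++ prefix o) (X ∧ᶠ base o) (ds ++ defs o) (next o)

_⊗_ : Output → Output → Output
o₁ ⊗ o₂ = output (prefix o₁ ++ prefix o₂) (base o₁ ∧ᶠ base o₂) (defs o₁ ++ defs o₂) (next o₂)

universally : ℕ → Output → Output
universally v o = output (∀q v ∷ prefix o) (base o) (defs o) (next o)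

rename : (ℕ → ℕ) → ℕ → ℕ → ℕ → ℕ
rename ρ p v q = if q ≡ᵇ p then v else ρ q

-- translate pol ρ κ v φ reads each atom q of φ as ρ q and allocates the fresh atoms v, v + 1, …, next − 1;
-- its formula holds at s iff on all states reachable from s, κ implies φ (pol = positive) or is implied by
-- φ (pol = negative).
translate : Polarity → (ℕ → ℕ) → ℕ → ℕ → Form → Output
translate pol ρ κ v (atom q) = output [] (AG (guard pol (atom κ) (atom (ρ q)))) [] v
translate pol ρ κ v (neg φ) =
  node (fresh∃ v 1) (AG (guard pol (atom κ) (neg (atom v)))) [] (translate (opposite pol) ρ v (1 + v) φ)
translate pol ρ κ v (φ ∨ᶠ ψ) =
  let o₁ = translate pol ρ v (2 + v) φ in
  node (fresh∃ v 2) (AG (guard pol (atom κ) (atom v ∨ᶠ atom (1 + v)))) []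
       (o₁ ⊗ translate pol ρ (1 + v) (next o₁) ψ)
translate pol ρ κ v (EX φ) =
  node (fresh∃ v 2) (AG (guard pol (atom κ) (atom (1 + v)))) ((1 + v , EX (atom v)) ∷ []) (translate pol ρ v (2 + v) φ)
translate pol ρ κ v (EU φ ψ) =
  let o₁ = translate pol ρ v (3 + v) φ in
  node (fresh∃ v 3) (AG (guard pol (atom κ) (atom (2 + v)))) ((2 + v , EU (atom v) (atom (1 + v))) ∷ [])
       (o₁ ⊗ translate pol ρ (1 + v) (next o₁) ψ)
translate pol ρ κ v (AU φ ψ) =
  let o₁ = translate pol ρ v (3 + v) φ in
  node (fresh∃ v 3) (AG (guard pol (atom κ) (atom (2 + v)))) ((2 + v , AU (atom v) (atom (1 + v))) ∷ [])
       (o₁ ⊗ translate pol ρ (1 + v) (next o₁) ψ)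
-- The marker v is universally quantified; 1 + v stands for p and 2 + v approximates φ.
translate positive ρ κ v (∃ₚ p φ) =
  node (∀q v ∷ fresh∃ (1 + v) 2) (EF (atom v ∧ᶠ atom κ) ⇒ᶠ EF (atom v ∧ᶠ atom (2 + v))) []
       (translate positive (rename ρ p (1 + v)) (2 + v) (3 + v) φ)
translate negative ρ κ v (∃ₚ p φ) = universally v (translate negative (rename ρ p v) κ (1 + v) φ)

-- Semantics of outputs

module Prenex (G : Graph) where
  open Semantics G

  agree-fresh : ∀ {P V} → Disjoint P V → ∀ {p} → V p → ∀ (L : Lab) f → Agree P L (relabel L p f)
  agree-fresh disj vp L f a pa t = sym (relabel-other L f t λ { refl → disj a pa vp })

  quantify-∧ : ∀ {P V} → Disjoint P V → ∀ {A} B {s} → AllAtoms P A → ∀ {Q} → AllBound V Q → ∀ L →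
               Sat G L (quantify Q (A ∧ᶠ B)) s ⇔ (Sat G L A s × Sat G L (quantify Q B) s)
  quantify-∧ disj {A} B hA [] L = sat-∧ A B
  quantify-∧ disj {A} B {s} hA {∃q p ∷ Q} (vp ∷ vQ) L =
    mk⇔ (λ (f , h) → let (a , b) = to (IH f) h in sat-local hA (agree-sym (agree-fresh disj vp L f)) s a , f , b)
        (λ (a , f , b) → f , from (IH f) (sat-local hA (agree-fresh disj vp L f) s a , b))
    where IH = λ f → quantify-∧ disj B hA vQ (relabel L p f)
  quantify-∧ disj {A} B {s} hA {∀q p ∷ Q} (vp ∷ vQ) L =
    mk⇔ (λ h → let H = λ f → to (IH f) (to (sat-∀ₚ p (quantify Q (A ∧ᶠ B))) h f)
               in sat-local hA (agree-sym (agree-fresh disj vp L _)) s (proj₁ (H (λ _ → false))) ,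
                  from (sat-∀ₚ p (quantify Q B)) (proj₂ ∘ H))
        (λ (a , b) → from (sat-∀ₚ p (quantify Q (A ∧ᶠ B)))
                       λ f → from (IH f) (sat-local hA (agree-fresh disj vp L f) s a , to (sat-∀ₚ p (quantify Q B)) b f))
    where IH = λ f → quantify-∧ disj B hA vQ (relabel L p f)

  sat-fresh∃ : ∀ k {L v X s} →
               Sat G L (quantify (fresh∃ v k) X) s ⇔ Σ (Vec Marking k) λ fs → Sat G (extend L v fs) X s
  sat-fresh∃ zero = mk⇔ (λ h → [] , h) (λ { ([] , h) → h })
  sat-fresh∃ (suc k) = mk⇔ (λ (f , h) → let (fs , h′) = to (sat-fresh∃ k) h in f ∷ fs , h′)
                           (λ { (f ∷ fs , h) → f , from (sat-fresh∃ k) (fs , h) })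

  sat-pull : ∀ {P V} → Disjoint P V → ∀ X ds C D {Q s} → AllAtoms P (conjAG X ds) → AllBound V Q → ∀ L →
             Sat G L (quantify Q (conjAG (X ∧ᶠ C) (ds ++ D))) s ⇔ Sat G L (conjAG X ds ∧ᶠ quantify Q (conjAG C D)) s
  sat-pull disj X ds C D {Q} hX vQ L =
    ⇔-sym (sat-∧ (conjAG X ds) _) ⇔-∘
      (quantify-∧ disj (conjAG C D) hX vQ L ⇔-∘ quantify-cong (λ L → sat-conjAG-∧ X C ds D) Q L)

  sat-node : ∀ {P V} → Disjoint P V → ∀ vs X ds o {s} → AllAtoms P (conjAG X ds) → AllBound V (prefix o) →
             ∀ L →
             Sat G L (formula (node vs X ds o)) s ⇔ Sat G L (quantify vs (conjAG X ds ∧ᶠ formula o)) s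
  sat-node disj vs X ds o hX vo L rewrite quantify-++ vs (prefix o) (conjAG (X ∧ᶠ base o) (ds ++ defs o)) =
    quantify-cong (sat-pull disj X ds (base o) (defs o) hX vo) vs L

  sat-⊗ : ∀ {P₁ V₁ P₂ V₂} → Disjoint P₁ V₁ → Disjoint P₂ V₂ → ∀ o₁ o₂ {s} →
          AllBound V₁ (prefix o₁) → AllAtoms P₁ (formula o₂) →
          AllBound V₂ (prefix o₂) → AllAtoms P₂ (conjAG (base o₁) (defs o₁)) → ∀ L →
          Sat G L (formula (o₁ ⊗ o₂)) s ⇔ (Sat G L (formula o₁) s × Sat G L (formula o₂) s)
  sat-⊗ disj₁ disj₂ o₁ o₂ v₁ h₂ v₂ h₁ L
    rewrite quantify-++ (prefix o₁) (prefix o₂) (conjAG (base o₁ ∧ᶠ base o₂) (defs o₁ ++ defs o₂)) =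
    swap⇔ ⇔-∘ (quantify-∧ disj₁ (conjAG (base o₁) (defs o₁)) h₂ v₁ L ⇔-∘
               quantify-cong pulled (prefix o₁) L)
    where
    swap⇔ : ∀ {A B : Set} → (A × B) ⇔ (B × A)
    swap⇔ = mk⇔ swap swap
    ∧-comm : ∀ {L A B t} → Sat G L (A ∧ᶠ B) t ⇔ Sat G L (B ∧ᶠ A) t
    ∧-comm {A = A} {B} = ⇔-sym (sat-∧ B A) ⇔-∘ (swap⇔ ⇔-∘ sat-∧ A B)
    pulled = λ L → ∧-comm ⇔-∘ sat-pull disj₂ (base o₁) (defs o₁) (base o₂) (defs o₂) h₁ v₂ L

-- Fresh atoms stay apart

DefAtoms : (ℕ → Set) → ℕ × Form → Set
DefAtoms P (κ , θ) = AllAtoms P (AG (atom κ ⇔ᶠ θ))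

allAtoms-quantify : ∀ {P Q X} → AllBound P Q → AllAtoms P X → AllAtoms P (quantify Q X)
allAtoms-quantify {Q = []} [] hX = hX
allAtoms-quantify {Q = ∃q p ∷ Q} (hp ∷ hQ) hX = ∃ₚ hp (allAtoms-quantify hQ hX)
allAtoms-quantify {Q = ∀q p ∷ Q} (hp ∷ hQ) hX = neg (∃ₚ hp (neg (allAtoms-quantify hQ hX)))

allAtoms-∧ : ∀ {P A B} → AllAtoms P A → AllAtoms P B → AllAtoms P (A ∧ᶠ B)
allAtoms-∧ hA hB = neg (neg hA ∨ᶠ neg hB)

allAtoms-⇒ : ∀ {P A B} → AllAtoms P A → AllAtoms P B → AllAtoms P (A ⇒ᶠ B)
allAtoms-⇒ hA hB = neg hA ∨ᶠ hB

allAtoms-guard : ∀ {P} pol {A B} → AllAtoms P A → AllAtoms P B → AllAtoms P (guard pol A B)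
allAtoms-guard positive hA hB = allAtoms-⇒ hA hB
allAtoms-guard negative hA hB = allAtoms-⇒ hB hA

allAtoms-EF : ∀ {P A} → P 0 → AllAtoms P A → AllAtoms P (EF A)
allAtoms-EF p0 hA = EU (atom p0 ∨ᶠ neg (atom p0)) hA

allAtoms-AG : ∀ {P A} → P 0 → AllAtoms P A → AllAtoms P (AG A)
allAtoms-AG p0 hA = neg (allAtoms-EF p0 (neg hA))

allAtoms-def : ∀ {P κ θ} → P 0 → P κ → AllAtoms P θ → DefAtoms P (κ , θ)
allAtoms-def p0 pκ hθ = allAtoms-AG p0 (allAtoms-∧ (allAtoms-⇒ (atom pκ) hθ) (allAtoms-⇒ hθ (atom pκ)))

allAtoms-conjAG : ∀ {P C D} → AllAtoms P C → All (DefAtoms P) D → AllAtoms P (conjAG C D)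
allAtoms-conjAG hC [] = hC
allAtoms-conjAG hC (hd ∷ hD) = allAtoms-∧ (allAtoms-conjAG hC hD) hd

In : ℕ → ℕ → ℕ → Set
In lo hi a = lo ≤ a × a < hi

fresh-in : ∀ {k} n (i : Fin k) → In n (k + n) (toℕ i + n)
fresh-in n i = ℕ.m≤n+m n (toℕ i) , ℕ.+-monoˡ-< n (toℕ<n i)

fresh∃-in : ∀ k n → AllBound (In n (k + n)) (fresh∃ n k)
fresh∃-in zero n = []
fresh∃-in (suc k) n = fresh-in n zero ∷ All.map (λ {q} → shift (bound q)) (fresh∃-in k (suc n))
  where
  shift : ∀ a → In (suc n) (k + suc n) a → In n (suc k + n) a
  shift a (1+n≤a , a<k+1+n) = ℕ.<⇒≤ 1+n≤a , subst (a <_) (ℕ.+-suc k n) a<k+1+n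

record Scoped (S : ℕ → Set) (n : ℕ) (o : Output) : Set where
  field
    grows       : n ≤ next o
    prefix-in   : AllBound (In n (next o)) (prefix o)
    base-atoms  : AllAtoms (λ a → S a ⊎ In n (next o) a) (base o)
    defs-atoms  : All (DefAtoms (λ a → S a ⊎ In n (next o) a)) (defs o)
open Scoped

scoped-formula : ∀ {S n o} → Scoped S n o → AllAtoms (λ a → S a ⊎ In n (next o) a) (formula o)
scoped-formula sc = allAtoms-quantify (All.map inj₂ (prefix-in sc)) (allAtoms-conjAG (base-atoms sc) (defs-atoms sc))

defsAtoms-mono : ∀ {P P′ : ℕ → Set} → (∀ {a} → P a → P′ a) → ∀ {D} →
                 All (DefAtoms P) D → All (DefAtoms P′) D
defsAtoms-mono P⊆P′ [] = []
defsAtoms-mono P⊆P′ (hd ∷ hD) = allAtoms-mono P⊆P′ hd ∷ defsAtoms-mono P⊆P′ hD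

in-widen : ∀ {lo hi lo′ hi′ a} → lo′ ≤ lo → hi ≤ hi′ → In lo hi a → In lo′ hi′ a
in-widen lo′≤lo hi≤hi′ (lo≤a , a<hi) = ℕ.≤-trans lo′≤lo lo≤a , ℕ.<-≤-trans a<hi hi≤hi′

in-nested : ∀ {S : ℕ → Set} {n m k a} → n ≤ m → m ≤ k → (S a ⊎ In n m a) ⊎ In m k a → S a ⊎ In n k a
in-nested n≤m m≤k (inj₁ (inj₁ sa)) = inj₁ sa
in-nested n≤m m≤k (inj₁ (inj₂ a∈)) = inj₂ (in-widen ℕ.≤-refl m≤k a∈)
in-nested n≤m m≤k (inj₂ a∈) = inj₂ (in-widen n≤m ℕ.≤-refl a∈)

node-scoped : ∀ {S n m vs X ds o} → n ≤ m → AllBound (In n m) vs → AllAtoms (λ a → S a ⊎ In n m a) X →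
              All (DefAtoms (λ a → S a ⊎ In n m a)) ds → Scoped (λ a → S a ⊎ In n m a) m o →
              Scoped S n (node vs X ds o)
node-scoped {S} {n} {m} {X = X} {o = o} n≤m vs-in hX hds sc = record
  { grows      = ℕ.≤-trans n≤m (grows sc)
  ; prefix-in  = ++⁺ (All.map (in-widen ℕ.≤-refl (grows sc)) vs-in) (All.map (in-widen n≤m ℕ.≤-refl) (prefix-in sc))
  ; base-atoms = allAtoms-∧ (allAtoms-mono local hX) (allAtoms-mono child (base-atoms sc))
  ; defs-atoms = ++⁺ (defsAtoms-mono local hds) (defsAtoms-mono child (defs-atoms sc))
  }
  where
  local : ∀ {a} → S a ⊎ In n m a → S a ⊎ In n (next o) a
  local = map₂ (in-widen ℕ.≤-refl (grows sc))
  child : ∀ {a} → (S a ⊎ In n m a) ⊎ In m (next o) a → S a ⊎ In n (next o) a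
  child = in-nested {S} n≤m (grows sc)

⊗-scoped : ∀ {S m o₁ o₂} → Scoped S m o₁ → Scoped S (next o₁) o₂ → Scoped S m (o₁ ⊗ o₂)
⊗-scoped {S} {m} {o₁} {o₂} sc₁ sc₂ = record
  { grows      = ℕ.≤-trans (grows sc₁) (grows sc₂)
  ; prefix-in  = ++⁺ (All.map (in-widen ℕ.≤-refl (grows sc₂)) (prefix-in sc₁))
                     (All.map (in-widen (grows sc₁) ℕ.≤-refl) (prefix-in sc₂))
  ; base-atoms = allAtoms-∧ (allAtoms-mono first (base-atoms sc₁)) (allAtoms-mono second (base-atoms sc₂))
  ; defs-atoms = ++⁺ (defsAtoms-mono first (defs-atoms sc₁)) (defsAtoms-mono second (defs-atoms sc₂))
  }
  where
  first : ∀ {a} → S a ⊎ In m (next o₁) a → S a ⊎ In m (next o₂) a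
  first = map₂ (in-widen ℕ.≤-refl (grows sc₂))
  second : ∀ {a} → S a ⊎ In (next o₁) (next o₂) a → S a ⊎ In m (next o₂) a
  second = map₂ (in-widen (grows sc₁) ℕ.≤-refl)

universally-scoped : ∀ {S n o} → Scoped (λ a → S a ⊎ In n (1 + n) a) (1 + n) o → Scoped S n (universally n o)
universally-scoped {S} {n} {o} sc = record
  { grows      = ℕ.<⇒≤ (grows sc)
  ; prefix-in  = (ℕ.≤-refl , grows sc) ∷ All.map (in-widen (ℕ.n≤1+n n) ℕ.≤-refl) (prefix-in sc)
  ; base-atoms = allAtoms-mono child (base-atoms sc)
  ; defs-atoms = defsAtoms-mono child (defs-atoms sc)
  }
  where
  child : ∀ {a} → (S a ⊎ In n (1 + n) a) ⊎ In (1 + n) (next o) a → S a ⊎ In n (next o) a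
  child = in-nested {S} (ℕ.n≤1+n n) (grows sc)

module Scoping (N : ℕ) where

  rename-preserves : ∀ {P : ℕ → Set} ρ p {v} → P v → (∀ q → q < N → P (ρ q)) →
                     ∀ q → q < N → P (rename ρ p v q)
  rename-preserves ρ p pv Pρ q q<N with q ≡ᵇ p
  ... | true = pv
  ... | false = Pρ q q<N

  fresh : ∀ {S : ℕ → Set} {k} n (i : Fin k) → S (toℕ i + n) ⊎ In n (k + n) (toℕ i + n)
  fresh n i = inj₂ (fresh-in n i)

  -- S 0 is needed because ⊤ᶠ, and hence every AG and EF, mentions the atom 0.
  translate-scoped : ∀ pol ρ κ v φ {S} → AllAtoms (_< N) φ → S 0 → S κ → (∀ q → q < N → S (ρ q)) →
                     Scoped S v (translate pol ρ κ v φ)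
  translate-scoped pol ρ κ v (atom q) (atom q<N) s0 sκ Sρ = record
    { grows = ℕ.≤-refl ; prefix-in = [] ; defs-atoms = []
    ; base-atoms = allAtoms-AG (inj₁ s0) (allAtoms-guard pol (atom (inj₁ sκ)) (atom (inj₁ (Sρ q q<N)))) }
  translate-scoped pol ρ κ v (neg φ) {S} (neg hφ) s0 sκ Sρ =
    node-scoped (ℕ.n≤1+n v) (fresh∃-in 1 v)
      (allAtoms-AG (inj₁ s0) (allAtoms-guard pol (atom (inj₁ sκ)) (neg (atom (fresh {S} v zero))))) []
      (translate-scoped (opposite pol) ρ v (1 + v) φ hφ (inj₁ s0) (fresh {S} v zero) (λ q h → inj₁ (Sρ q h)))
  translate-scoped pol ρ κ v (φ ∨ᶠ ψ) {S} (hφ ∨ᶠ hψ) s0 sκ Sρ =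
    node-scoped (ℕ.m≤n+m v 2) (fresh∃-in 2 v)
      (allAtoms-AG (inj₁ s0) (allAtoms-guard pol (atom (inj₁ sκ))
                                                  (atom (fresh {S} v zero) ∨ᶠ atom (fresh {S} v (suc zero))))) []
      (⊗-scoped (translate-scoped pol ρ v (2 + v) φ hφ (inj₁ s0) (fresh {S} v zero) (λ q h → inj₁ (Sρ q h)))
                (translate-scoped pol ρ (1 + v) _ ψ hψ (inj₁ s0) (fresh {S} v (suc zero)) (λ q h → inj₁ (Sρ q h))))
  translate-scoped pol ρ κ v (EX φ) {S} (EX hφ) s0 sκ Sρ =
    node-scoped (ℕ.m≤n+m v 2) (fresh∃-in 2 v)
      (allAtoms-AG (inj₁ s0) (allAtoms-guard pol (atom (inj₁ sκ)) (atom (fresh {S} v (suc zero)))))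
      (allAtoms-def (inj₁ s0) (fresh {S} v (suc zero)) (EX (atom (fresh {S} v zero))) ∷ [])
      (translate-scoped pol ρ v (2 + v) φ hφ (inj₁ s0) (fresh {S} v zero) (λ q h → inj₁ (Sρ q h)))
  translate-scoped pol ρ κ v (EU φ ψ) {S} (EU hφ hψ) s0 sκ Sρ =
    node-scoped (ℕ.m≤n+m v 3) (fresh∃-in 3 v)
      (allAtoms-AG (inj₁ s0) (allAtoms-guard pol (atom (inj₁ sκ)) (atom (fresh {S} v (suc (suc zero))))))
      (allAtoms-def (inj₁ s0) (fresh {S} v (suc (suc zero)))
                    (EU (atom (fresh {S} v zero)) (atom (fresh {S} v (suc zero)))) ∷ [])
      (⊗-scoped (translate-scoped pol ρ v (3 + v) φ hφ (inj₁ s0) (fresh {S} v zero) (λ q h → inj₁ (Sρ q h)))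
                (translate-scoped pol ρ (1 + v) _ ψ hψ (inj₁ s0) (fresh {S} v (suc zero)) (λ q h → inj₁ (Sρ q h))))
  translate-scoped pol ρ κ v (AU φ ψ) {S} (AU hφ hψ) s0 sκ Sρ =
    node-scoped (ℕ.m≤n+m v 3) (fresh∃-in 3 v)
      (allAtoms-AG (inj₁ s0) (allAtoms-guard pol (atom (inj₁ sκ)) (atom (fresh {S} v (suc (suc zero))))))
      (allAtoms-def (inj₁ s0) (fresh {S} v (suc (suc zero)))
                    (AU (atom (fresh {S} v zero)) (atom (fresh {S} v (suc zero)))) ∷ [])
      (⊗-scoped (translate-scoped pol ρ v (3 + v) φ hφ (inj₁ s0) (fresh {S} v zero) (λ q h → inj₁ (Sρ q h)))
                (translate-scoped pol ρ (1 + v) _ ψ hψ (inj₁ s0) (fresh {S} v (suc zero)) (λ q h → inj₁ (Sρ q h))))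
  translate-scoped positive ρ κ v (∃ₚ p φ) {S} (∃ₚ _ hφ) s0 sκ Sρ =
    node-scoped (ℕ.m≤n+m v 3) (fresh-in v zero ∷ All.map (in-widen (ℕ.n≤1+n v) ℕ.≤-refl) (fresh∃-in 2 (1 + v)))
      (allAtoms-⇒ (allAtoms-EF (inj₁ s0) (allAtoms-∧ (atom (fresh {S} v zero)) (atom (inj₁ sκ))))
                  (allAtoms-EF (inj₁ s0) (allAtoms-∧ (atom (fresh {S} v zero)) (atom (fresh {S} v (suc (suc zero))))))) []
      (translate-scoped positive (rename ρ p (1 + v)) (2 + v) (3 + v) φ hφ (inj₁ s0) (fresh {S} v (suc (suc zero)))
        (rename-preserves {λ a → S a ⊎ In v (3 + v) a} ρ p (fresh {S} v (suc zero)) (λ q h → inj₁ (Sρ q h))))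
  translate-scoped negative ρ κ v (∃ₚ p φ) {S} (∃ₚ _ hφ) s0 sκ Sρ =
    universally-scoped (translate-scoped negative (rename ρ p v) κ (1 + v) φ hφ (inj₁ s0) (inj₁ sκ)
      (rename-preserves {λ a → S a ⊎ In v (1 + v) a} ρ p (fresh {S} v zero) (λ q h → inj₁ (Sρ q h))))

-- Correctness of the translation

module Correctness (N : ℕ) (G : Graph) (s : Fin (Graph.n G)) where
  open Semantics G
  open Prenex G

  Atom : Lab → ℕ → State
  Atom L a t = L a t ≡ true

  data Below (P Q : State) : Polarity → Set where
    lower : P ⊆⟨ s ⟩ Q → Below P Q positive
    upper : Q ⊆⟨ s ⟩ P → Below P Q negative

  syntax Below P Q pol = P ⊑[ pol ] Q

  _≐_ : State → State → Set
  P ≐ Q = ∀ t → Reach s t → P t ⇔ Q t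

  ≐-sym : ∀ {P Q} → P ≐ Q → Q ≐ P
  ≐-sym P≐Q t r = ⇔-sym (P≐Q t r)

  ≐-trans : ∀ {P Q R} → P ≐ Q → Q ≐ R → P ≐ R
  ≐-trans P≐Q Q≐R t r = Q≐R t r ⇔-∘ P≐Q t r

  ⊑-trans : ∀ {pol P Q R} → P ⊑[ pol ] Q → Q ⊑[ pol ] R → P ⊑[ pol ] R
  ⊑-trans (lower P⊆Q) (lower Q⊆R) = lower λ t r → Q⊆R t r ∘ P⊆Q t r
  ⊑-trans (upper Q⊆P) (upper R⊆Q) = upper λ t r → Q⊆P t r ∘ R⊆Q t r

  ≐⇒⊑ : ∀ pol {P Q} → P ≐ Q → P ⊑[ pol ] Q
  ≐⇒⊑ positive P≐Q = lower λ t r → to (P≐Q t r)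
  ≐⇒⊑ negative P≐Q = upper λ t r → from (P≐Q t r)

  ⊑-mono₁ : ∀ {Op} → Monotone₁ Op → ∀ {pol P P′} → P ⊑[ pol ] P′ → Op P ⊑[ pol ] Op P′
  ⊑-mono₁ mono (lower P⊆P′) = lower (mono P⊆P′)
  ⊑-mono₁ mono (upper P′⊆P) = upper (mono P′⊆P)

  ⊑-mono₂ : ∀ {Op} → Monotone₂ Op → ∀ {pol P P′ Q Q′} →
            P ⊑[ pol ] P′ → Q ⊑[ pol ] Q′ → Op P Q ⊑[ pol ] Op P′ Q′
  ⊑-mono₂ mono (lower P⊆P′) (lower Q⊆Q′) = lower (mono P⊆P′ Q⊆Q′)
  ⊑-mono₂ mono (upper P′⊆P) (upper Q′⊆Q) = upper (mono P′⊆P Q′⊆Q)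

  ⊑-neg : ∀ {pol P P′} → P ⊑[ opposite pol ] P′ → (λ t → ¬ P t) ⊑[ pol ] (λ t → ¬ P′ t)
  ⊑-neg {positive} (upper P′⊆P) = lower λ t r ¬p p′ → ¬p (P′⊆P t r p′)
  ⊑-neg {negative} (lower P⊆P′) = upper λ t r ¬p′ p → ¬p′ (P⊆P′ t r p)

  ≐-mono₁ : ∀ {Op} → Monotone₁ Op → ∀ {P P′} → P ≐ P′ → Op P ≐ Op P′
  ≐-mono₁ mono P≐P′ t r = mk⇔ (mono (λ t r → to (P≐P′ t r)) t r) (mono (λ t r → from (P≐P′ t r)) t r)

  ≐-mono₂ : ∀ {Op} → Monotone₂ Op → ∀ {P P′ Q Q′} → P ≐ P′ → Q ≐ Q′ → Op P Q ≐ Op P′ Q′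
  ≐-mono₂ mono P≐P′ Q≐Q′ t r =
    mk⇔ (mono (λ t r → to (P≐P′ t r)) (λ t r → to (Q≐Q′ t r)) t r)
        (mono (λ t r → from (P≐P′ t r)) (λ t r → from (Q≐Q′ t r)) t r)

  sat-AG-guard : ∀ {L} pol A B → Sat G L (AG (guard pol A B)) s ⇔ (Sat G L A ⊑[ pol ] Sat G L B)
  sat-AG-guard positive A B = mk⇔ (λ h → lower λ t r → to (sat-⇒ A B) (to (sat-AG (A ⇒ᶠ B)) h t r))
                                  (λ { (lower A⊆B) → from (sat-AG (A ⇒ᶠ B)) λ t r → from (sat-⇒ A B) (A⊆B t r) })
  sat-AG-guard negative A B = mk⇔ (λ h → upper λ t r → to (sat-⇒ B A) (to (sat-AG (B ⇒ᶠ A)) h t r))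
                                  (λ { (upper B⊆A) → from (sat-AG (B ⇒ᶠ A)) λ t r → from (sat-⇒ B A) (B⊆A t r) })

  sat-AG-⇔ : ∀ {L} A B → Sat G L (AG (A ⇔ᶠ B)) s ⇔ (Sat G L A ≐ Sat G L B)
  sat-AG-⇔ A B = mk⇔ (λ h t r → to (sat-⇔ A B) (to (sat-AG (A ⇔ᶠ B)) h t r))
                     (λ h → from (sat-AG (A ⇔ᶠ B)) λ t r → from (sat-⇔ A B) (h t r))

  atom-extend : ∀ {k} L v (fs : Vec _ k) i → Atom (extend L v fs) (toℕ i + v) ≐ λ t → lookup fs i t ≡ true
  atom-extend L v fs i t _ = mk⇔ (trans (sym (extend-lookup L v fs i t))) (trans (extend-lookup L v fs i t))

  atom-extend-below : ∀ {k} L v (fs : Vec _ k) {a} → a < v → Atom (extend L v fs) a ≐ Atom L a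
  atom-extend-below L v fs a<v t _ = mk⇔ (trans (sym (extend-below L fs t a<v))) (trans (extend-below L fs t a<v))

  Renames : (ℕ → ℕ) → ℕ → Set
  Renames ρ n = ∀ q → q < N → ρ q < n

  Tracks : (ℕ → ℕ) → Lab → Lab → Set
  Tracks ρ L L₀ = ∀ q → q < N → ∀ t → L (ρ q) t ≡ L₀ q t

  tracks-extend : ∀ {k ρ v L L₀} (fs : Vec _ k) → Renames ρ v → Tracks ρ L L₀ → Tracks ρ (extend L v fs) L₀
  tracks-extend {L = L} fs ρ<v tracks q q<N t = trans (extend-below L fs t (ρ<v q q<N)) (tracks q q<N t)

  tracks-rename : ∀ {ρ L L₀} p v f → (∀ t → L v t ≡ f t) → Tracks ρ L L₀ →
                  Tracks (rename ρ p v) L (relabel L₀ p f)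
  tracks-rename p v f Lv≡f tracks q q<N t with q ≡ᵇ p
  ... | true = Lv≡f t
  ... | false = tracks q q<N t

  Implements : Polarity → (ℕ → ℕ) → Lab → ℕ → Form → Output → Set
  Implements pol ρ L₀ κ φ o = ∀ L → Tracks ρ L L₀ → Sat G L (formula o) s ⇔ (Atom L κ ⊑[ pol ] Sat G L₀ φ)

  sat-node∃ : ∀ {v} k X ds o → AllAtoms (_< k + v) (conjAG X ds) → AllBound (k + v ≤_) (prefix o) → ∀ L →
              Sat G L (formula (node (fresh∃ v k) X ds o)) s ⇔
              Σ (Vec Marking k) λ fs → Sat G (extend L v fs) (conjAG X ds) s × Sat G (extend L v fs) (formula o) s
  sat-node∃ {v} k X ds o hX vo L =
    mk⇔ (λ (fs , h) → fs , to (sat-∧ (conjAG X ds) (formula o)) h)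
        (λ (fs , h) → fs , from (sat-∧ (conjAG X ds) (formula o)) h)
      ⇔-∘ (sat-fresh∃ k ⇔-∘ sat-node (λ a a<m m≤a → ℕ.<⇒≱ a<m m≤a) (fresh∃ v k) X ds o hX vo L)

  prefix-above : ∀ {S m o} → Scoped S m o → AllBound (m ≤_) (prefix o)
  prefix-above sc = All.map proj₁ (prefix-in sc)

  sat-⊗-scoped : ∀ {m o₁ o₂} → Scoped (_< m) m o₁ → Scoped (_< m) (next o₁) o₂ → ∀ L →
                 Sat G L (formula (o₁ ⊗ o₂)) s ⇔ (Sat G L (formula o₁) s × Sat G L (formula o₂) s)
  sat-⊗-scoped {m} {o₁} {o₂} sc₁ sc₂ =
    sat-⊗ disj₁ disj₂ o₁ o₂ (prefix-in sc₁) (allAtoms-mono (map₂ proj₁) (scoped-formula sc₂))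
          (prefix-above sc₂)
          (allAtoms-conjAG (allAtoms-mono below (base-atoms sc₁)) (defsAtoms-mono below (defs-atoms sc₁)))
    where
    disj₁ : Disjoint (λ a → a < m ⊎ next o₁ ≤ a) (In m (next o₁))
    disj₁ a (inj₁ a<m) (m≤a , _) = ℕ.<⇒≱ a<m m≤a
    disj₁ a (inj₂ next≤a) (_ , a<next) = ℕ.<⇒≱ a<next next≤a
    disj₂ : Disjoint (_< next o₁) (next o₁ ≤_)
    disj₂ a a<next next≤a = ℕ.<⇒≱ a<next next≤a
    below : ∀ {a} → a < m ⊎ In m (next o₁) a → a < next o₁
    below (inj₁ a<m) = ℕ.<-≤-trans a<m (grows sc₁)
    below (inj₂ (_ , a<next)) = a<next

  ⊑-respʳ : ∀ {pol P Q Q′} → Q ≐ Q′ → (P ⊑[ pol ] Q) ⇔ (P ⊑[ pol ] Q′)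
  ⊑-respʳ {pol} Q≐Q′ = mk⇔ (λ b → ⊑-trans b (≐⇒⊑ pol Q≐Q′))
                           (λ b → ⊑-trans b (≐⇒⊑ pol (≐-sym Q≐Q′)))

  ⊑⁺⇒⊆ : ∀ {P Q} → P ⊑[ positive ] Q → P ⊆⟨ s ⟩ Q
  ⊑⁺⇒⊆ (lower P⊆Q) = P⊆Q

  ⊑⁻⇒⊇ : ∀ {P Q} → P ⊑[ negative ] Q → Q ⊆⟨ s ⟩ P
  ⊑⁻⇒⊇ (upper Q⊆P) = Q⊆P

  sat-guard-def : ∀ {L} pol κ c θ → Sat G L (AG (guard pol (atom κ) (atom c)) ∧ᶠ AG (atom c ⇔ᶠ θ)) s ⇔
                  ((Atom L κ ⊑[ pol ] Atom L c) × (Atom L c ≐ Sat G L θ))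
  sat-guard-def pol κ c θ =
    (sat-AG-guard pol (atom κ) (atom c) ×-⇔ sat-AG-⇔ (atom c) θ)
      ⇔-∘ sat-∧ (AG (guard pol (atom κ) (atom c))) (AG (atom c ⇔ᶠ θ))

  Meet : Lab → ℕ → ℕ → Set
  Meet L a b = ∃ λ t → Reach s t × Atom L a t × Atom L b t

  sat-EF-∧ : ∀ {L} a b → Sat G L (EF (atom a ∧ᶠ atom b)) s ⇔ Meet L a b
  sat-EF-∧ {L} a b =
    mk⇔ (λ h → let (t , r , ab) = to (sat-EF {L} (atom a ∧ᶠ atom b)) h
                   (x , y) = to (sat-∧ {L} (atom a) (atom b)) ab
               in t , r , x , y)
        (λ (t , r , x , y) → from (sat-EF {L} (atom a ∧ᶠ atom b)) (t , r , from (sat-∧ {L} (atom a) (atom b)) (x , y)))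

  sat-meets : ∀ {L} a b c →
              Sat G L (EF (atom a ∧ᶠ atom b) ⇒ᶠ EF (atom a ∧ᶠ atom c)) s ⇔ (Meet L a b → Meet L a c)
  sat-meets {L} a b c =
    mk⇔ (λ h m → to (sat-EF-∧ {L} a c) (to ⇒-sat h (from (sat-EF-∧ {L} a b) m)))
        (λ f → from ⇒-sat λ e → from (sat-EF-∧ {L} a c) (f (to (sat-EF-∧ {L} a b) e)))
    where ⇒-sat = sat-⇒ {L} (EF (atom a ∧ᶠ atom b)) (EF (atom a ∧ᶠ atom c))

  open Scoping N using (translate-scoped; rename-preserves)

  fresh< : ∀ {k} v (i : Fin k) → toℕ i + v < k + v
  fresh< v i = proj₂ (fresh-in v i)

  fresh-above : ∀ {a v} k → a < v → a < k + v
  fresh-above {v = v} k a<v = ℕ.<-≤-trans a<v (ℕ.m≤n+m v k)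

  renames-≤ : ∀ {ρ v w} → v ≤ w → Renames ρ v → Renames ρ w
  renames-≤ v≤w ρ<v q q<N = ℕ.<-≤-trans (ρ<v q q<N) v≤w

  scoped : ∀ pol ρ κ m φ → AllAtoms (_< N) φ → κ < m → Renames ρ m → Scoped (_< m) m (translate pol ρ κ m φ)
  scoped pol ρ κ m φ hφ κ<m ρ<m = translate-scoped pol ρ κ m φ hφ (ℕ.≤-<-trans z≤n κ<m) κ<m ρ<m

  Correct : Polarity → Form → Set
  Correct pol φ = ∀ ρ κ v L₀ → κ < v → Renames ρ v → Implements pol ρ L₀ κ φ (translate pol ρ κ v φ)

  module BinaryChildren (pol : Polarity) {φ ψ} (hφ : AllAtoms (_< N) φ) (hψ : AllAtoms (_< N) ψ)
                        (ρ : ℕ → ℕ) (v k : ℕ) (ρ<v : Renames ρ v) (1+v<k+v : 1 + v < k + v) where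

    o₁ o₂ : Output
    o₁ = translate pol ρ v (k + v) φ
    o₂ = translate pol ρ (1 + v) (next o₁) ψ

    v<k+v : v < k + v
    v<k+v = ℕ.<-trans (ℕ.n<1+n v) 1+v<k+v

    ρ<k+v : Renames ρ (k + v)
    ρ<k+v = renames-≤ (ℕ.m≤n+m v k) ρ<v

    sc₁ : Scoped (_< k + v) (k + v) o₁
    sc₁ = scoped pol ρ v (k + v) φ hφ v<k+v ρ<k+v

    sc₂ : Scoped (_< k + v) (next o₁) o₂
    sc₂ = translate-scoped pol ρ (1 + v) (next o₁) ψ hψ (ℕ.≤-<-trans z≤n v<k+v) 1+v<k+v ρ<k+v

    IH₁ : Correct pol φ → ∀ L₀ → Implements pol ρ L₀ v φ o₁
    IH₁ IHφ L₀ = IHφ ρ v (k + v) L₀ v<k+v ρ<k+v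

    IH₂ : Correct pol ψ → ∀ L₀ → Implements pol ρ L₀ (1 + v) ψ o₂
    IH₂ IHψ L₀ =
      IHψ ρ (1 + v) (next o₁) L₀ (ℕ.<-≤-trans 1+v<k+v (grows sc₁)) (renames-≤ (grows sc₁) ρ<k+v)

  correct-atom : ∀ {pol q} → q < N → Correct pol (atom q)
  correct-atom {pol} {q} q<N ρ κ v L₀ κ<v ρ<v L tracks =
    ⊑-respʳ (λ t _ → mk⇔ (trans (sym (tracks q q<N t))) (trans (tracks q q<N t)))
      ⇔-∘ sat-AG-guard {L} pol (atom κ) (atom (ρ q))

  correct-neg : ∀ {pol φ} → AllAtoms (_< N) φ → Correct (opposite pol) φ → Correct pol (neg φ)
  correct-neg {pol} {φ} hφ IHφ ρ κ v L₀ κ<v ρ<v L tracks = mk⇔ to′ from′ ⇔-∘ sat-node∃ 1 X [] o hX vo L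
    where
    X = AG (guard pol (atom κ) (neg (atom v)))
    o = translate (opposite pol) ρ v (1 + v) φ
    ρ<1+v = renames-≤ (ℕ.n≤1+n v) ρ<v
    vo = prefix-above (scoped (opposite pol) ρ v (1 + v) φ hφ ℕ.≤-refl ρ<1+v)
    IH = IHφ ρ v (1 + v) L₀ ℕ.≤-refl ρ<1+v
    hX : AllAtoms (_< 1 + v) X
    hX = allAtoms-AG (s≤s z≤n) (allAtoms-guard pol (atom (ℕ.m<n⇒m<1+n κ<v)) (neg (atom ℕ.≤-refl)))
    to′ : _ → Atom L κ ⊑[ pol ] Sat G L₀ (neg φ)
    to′ (fs , x , h) = ⊑-trans (≐⇒⊑ pol (≐-sym (atom-extend-below L v fs κ<v)))
                         (⊑-trans (to (sat-AG-guard pol _ _) x)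
                                  (⊑-neg (to (IH _ (tracks-extend {L = L} fs ρ<v tracks)) h)))
    from′ : Atom L κ ⊑[ pol ] Sat G L₀ (neg φ) → _
    from′ κ⊑¬φ = fs , from (sat-AG-guard pol _ _) κ′⊑¬a ,
                 from (IH _ (tracks-extend {L = L} fs ρ<v tracks)) (≐⇒⊑ (opposite pol) a≐φ)
      where
      fs = truth L₀ φ ∷ []
      a≐φ : Atom (extend L v fs) v ≐ Sat G L₀ φ
      a≐φ t r = does-sat L₀ φ t ⇔-∘ atom-extend L v fs zero t r
      κ′⊑¬a = ⊑-trans (≐⇒⊑ pol (atom-extend-below L v fs κ<v))
                (⊑-trans κ⊑¬φ (⊑-neg (≐⇒⊑ (opposite pol) (≐-sym a≐φ))))

  correct-or : ∀ {pol φ ψ} → AllAtoms (_< N) φ → AllAtoms (_< N) ψ →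
               Correct pol φ → Correct pol ψ → Correct pol (φ ∨ᶠ ψ)
  correct-or {pol} {φ} {ψ} hφ hψ IHφ IHψ ρ κ v L₀ κ<v ρ<v L tracks =
    mk⇔ to′ from′ ⇔-∘ sat-node∃ 2 X [] (o₁ ⊗ o₂) hX (prefix-above (⊗-scoped sc₁ sc₂)) L
    where
    open BinaryChildren pol hφ hψ ρ v 2 ρ<v (fresh< v (suc zero))
    X = AG (guard pol (atom κ) (atom v ∨ᶠ atom (1 + v)))
    hX : AllAtoms (_< 2 + v) X
    hX = allAtoms-AG (s≤s z≤n) (allAtoms-guard pol (atom (fresh-above 2 κ<v))
                                                   (atom (fresh< v zero) ∨ᶠ atom (fresh< v (suc zero))))
    to′ : _ → Atom L κ ⊑[ pol ] Sat G L₀ (φ ∨ᶠ ψ)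
    to′ (fs , x , h) =
      let (h₁ , h₂) = to (sat-⊗-scoped sc₁ sc₂ _) h
          tracks′ = tracks-extend {L = L} fs ρ<v tracks
      in ⊑-trans (≐⇒⊑ pol (≐-sym (atom-extend-below L v fs κ<v)))
           (⊑-trans (to (sat-AG-guard pol _ _) x)
                    (⊑-mono₂ ∪-mono (to (IH₁ IHφ L₀ _ tracks′) h₁) (to (IH₂ IHψ L₀ _ tracks′) h₂)))
    from′ : Atom L κ ⊑[ pol ] Sat G L₀ (φ ∨ᶠ ψ) → _
    from′ κ⊑φ∨ψ = fs , from (sat-AG-guard pol _ _) κ′⊑a∨b ,
                  from (sat-⊗-scoped sc₁ sc₂ _)
                       (from (IH₁ IHφ L₀ _ tracks′) (≐⇒⊑ pol a≐φ) ,
                        from (IH₂ IHψ L₀ _ tracks′) (≐⇒⊑ pol b≐ψ))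
      where
      fs = truth L₀ φ ∷ truth L₀ ψ ∷ []
      tracks′ = tracks-extend {L = L} fs ρ<v tracks
      a≐φ : Atom (extend L v fs) v ≐ Sat G L₀ φ
      a≐φ t r = does-sat L₀ φ t ⇔-∘ atom-extend L v fs zero t r
      b≐ψ : Atom (extend L v fs) (1 + v) ≐ Sat G L₀ ψ
      b≐ψ t r = does-sat L₀ ψ t ⇔-∘ atom-extend L v fs (suc zero) t r
      κ′⊑a∨b = ⊑-trans (≐⇒⊑ pol (atom-extend-below L v fs κ<v))
                 (⊑-trans κ⊑φ∨ψ (≐⇒⊑ pol (≐-mono₂ ∪-mono (≐-sym a≐φ) (≐-sym b≐ψ))))

  correct-EX : ∀ {pol φ} → AllAtoms (_< N) φ → Correct pol φ → Correct pol (EX φ)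
  correct-EX {pol} {φ} hφ IHφ ρ κ v L₀ κ<v ρ<v L tracks = mk⇔ to′ from′ ⇔-∘ sat-node∃ 2 X ds o hX vo L
    where
    X = AG (guard pol (atom κ) (atom (1 + v)))
    ds = (1 + v , EX (atom v)) ∷ []
    o = translate pol ρ v (2 + v) φ
    ρ<2+v = renames-≤ (ℕ.m≤n+m v 2) ρ<v
    vo = prefix-above (scoped pol ρ v (2 + v) φ hφ (fresh< v zero) ρ<2+v)
    IH = IHφ ρ v (2 + v) L₀ (fresh< v zero) ρ<2+v
    hX : AllAtoms (_< 2 + v) (conjAG X ds)
    hX = allAtoms-conjAG (allAtoms-AG (s≤s z≤n) (allAtoms-guard pol (atom (fresh-above 2 κ<v))
                                                                     (atom (fresh< v (suc zero)))))
                         (allAtoms-def (s≤s z≤n) (fresh< v (suc zero)) (EX (atom (fresh< v zero))) ∷ [])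
    to′ : _ → Atom L κ ⊑[ pol ] Sat G L₀ (EX φ)
    to′ (fs , local , h) =
      let (κ⊑c , c≐EXa) = to (sat-guard-def pol κ (1 + v) (EX (atom v))) local
      in ⊑-trans (≐⇒⊑ pol (≐-sym (atom-extend-below L v fs κ<v)))
           (⊑-trans κ⊑c (⊑-trans (≐⇒⊑ pol c≐EXa)
                                  (⊑-mono₁ EXₚ-mono (to (IH _ (tracks-extend {L = L} fs ρ<v tracks)) h))))
    from′ : Atom L κ ⊑[ pol ] Sat G L₀ (EX φ) → _
    from′ κ⊑EXφ = fs , from (sat-guard-def pol κ (1 + v) (EX (atom v))) (κ′⊑c , c≐EXa) ,
                  from (IH _ (tracks-extend {L = L} fs ρ<v tracks)) (≐⇒⊑ pol a≐φ)
      where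
      fs = truth L₀ φ ∷ truth L₀ (EX φ) ∷ []
      a≐φ : Atom (extend L v fs) v ≐ Sat G L₀ φ
      a≐φ t r = does-sat L₀ φ t ⇔-∘ atom-extend L v fs zero t r
      c≐EXφ : Atom (extend L v fs) (1 + v) ≐ Sat G L₀ (EX φ)
      c≐EXφ t r = does-sat L₀ (EX φ) t ⇔-∘ atom-extend L v fs (suc zero) t r
      κ′⊑c = ⊑-trans (≐⇒⊑ pol (atom-extend-below L v fs κ<v))
               (⊑-trans κ⊑EXφ (≐⇒⊑ pol (≐-sym c≐EXφ)))
      c≐EXa = ≐-trans c≐EXφ (≐-mono₁ EXₚ-mono (≐-sym a≐φ))

  correct-until : ∀ (op : Form → Form → Form) {Op} → Monotone₂ Op →
                  (∀ {L φ ψ} → Sat G L (op φ ψ) ≐ Op (Sat G L φ) (Sat G L ψ)) →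
                  (∀ {P a b} → P a → P b → AllAtoms P (op (atom a) (atom b))) →
                  ∀ {pol φ ψ} → AllAtoms (_< N) φ → AllAtoms (_< N) ψ → Correct pol φ → Correct pol ψ →
                  ∀ ρ κ v L₀ → κ < v → Renames ρ v →
                  Implements pol ρ L₀ κ (op φ ψ)
                    (node (fresh∃ v 3) (AG (guard pol (atom κ) (atom (2 + v)))) ((2 + v , op (atom v) (atom (1 + v))) ∷ [])
                          (translate pol ρ v (3 + v) φ ⊗
                           translate pol ρ (1 + v) (next (translate pol ρ v (3 + v) φ)) ψ))
  correct-until op {Op} Op-mono sat-op op-atoms {pol} {φ} {ψ} hφ hψ IHφ IHψ ρ κ v L₀ κ<v ρ<v L tracks =
    mk⇔ to′ from′ ⇔-∘ sat-node∃ 3 X ds (o₁ ⊗ o₂) hX (prefix-above (⊗-scoped sc₁ sc₂)) L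
    where
    open BinaryChildren pol hφ hψ ρ v 3 ρ<v (fresh< v (suc zero))
    X = AG (guard pol (atom κ) (atom (2 + v)))
    ds = (2 + v , op (atom v) (atom (1 + v))) ∷ []
    hX : AllAtoms (_< 3 + v) (conjAG X ds)
    hX = allAtoms-conjAG (allAtoms-AG (s≤s z≤n) (allAtoms-guard pol (atom (fresh-above 3 κ<v))
                                                                     (atom (fresh< v (suc (suc zero))))))
                         (allAtoms-def (s≤s z≤n) (fresh< v (suc (suc zero)))
                                       (op-atoms (fresh< v zero) (fresh< v (suc zero))) ∷ [])
    to′ : _ → Atom L κ ⊑[ pol ] Sat G L₀ (op φ ψ)
    to′ (fs , local , h) =
      let (κ⊑c , c≐op) = to (sat-guard-def pol κ (2 + v) (op (atom v) (atom (1 + v)))) local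
          (h₁ , h₂) = to (sat-⊗-scoped sc₁ sc₂ _) h
          tracks′ = tracks-extend {L = L} fs ρ<v tracks
      in ⊑-trans (≐⇒⊑ pol (≐-sym (atom-extend-below L v fs κ<v)))
           (⊑-trans κ⊑c (⊑-trans (≐⇒⊑ pol (≐-trans c≐op sat-op))
             (⊑-trans (⊑-mono₂ Op-mono (to (IH₁ IHφ L₀ _ tracks′) h₁) (to (IH₂ IHψ L₀ _ tracks′) h₂))
                      (≐⇒⊑ pol (≐-sym sat-op)))))
    from′ : Atom L κ ⊑[ pol ] Sat G L₀ (op φ ψ) → _
    from′ κ⊑opφψ = fs , from (sat-guard-def pol κ (2 + v) (op (atom v) (atom (1 + v)))) (κ′⊑c , c≐op) ,
                   from (sat-⊗-scoped sc₁ sc₂ _)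
                        (from (IH₁ IHφ L₀ _ tracks′) (≐⇒⊑ pol a≐φ) ,
                         from (IH₂ IHψ L₀ _ tracks′) (≐⇒⊑ pol b≐ψ))
      where
      fs = truth L₀ φ ∷ truth L₀ ψ ∷ truth L₀ (op φ ψ) ∷ []
      tracks′ = tracks-extend {L = L} fs ρ<v tracks
      a≐φ : Atom (extend L v fs) v ≐ Sat G L₀ φ
      a≐φ t r = does-sat L₀ φ t ⇔-∘ atom-extend L v fs zero t r
      b≐ψ : Atom (extend L v fs) (1 + v) ≐ Sat G L₀ ψ
      b≐ψ t r = does-sat L₀ ψ t ⇔-∘ atom-extend L v fs (suc zero) t r
      c≐opφψ : Atom (extend L v fs) (2 + v) ≐ Sat G L₀ (op φ ψ)
      c≐opφψ t r = does-sat L₀ (op φ ψ) t ⇔-∘ atom-extend L v fs (suc (suc zero)) t r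
      κ′⊑c = ⊑-trans (≐⇒⊑ pol (atom-extend-below L v fs κ<v))
               (⊑-trans κ⊑opφψ (≐⇒⊑ pol (≐-sym c≐opφψ)))
      c≐op = ≐-trans c≐opφψ
               (≐-trans sat-op (≐-trans (≐-mono₂ Op-mono (≐-sym a≐φ) (≐-sym b≐ψ)) (≐-sym sat-op)))

  correct-∃⁻ : ∀ {φ p} → Correct negative φ → Correct negative (∃ₚ p φ)
  correct-∃⁻ {φ} {p} IHφ ρ κ v L₀ κ<v ρ<v L tracks =
    mk⇔ (λ h → upper λ t r (f , hφ) →
                 to (atom-extend-below L v (f ∷ []) κ<v t r) (⊑⁻⇒⊇ (to (IH f _ (tracks′ f)) (h f)) t r hφ))
        (λ { (upper ∃φ⊆κ) f → from (IH f _ (tracks′ f)) (upper λ t r hφ →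
                                  from (atom-extend-below L v (f ∷ []) κ<v t r) (∃φ⊆κ t r (f , hφ))) })
      ⇔-∘ sat-∀ₚ v (formula (translate negative (rename ρ p v) κ (1 + v) φ))
    where
    IH : ∀ f → Implements negative (rename ρ p v) (relabel L₀ p f) κ φ
                 (translate negative (rename ρ p v) κ (1 + v) φ)
    IH f = IHφ (rename ρ p v) κ (1 + v) (relabel L₀ p f) (ℕ.m<n⇒m<1+n κ<v)
               (rename-preserves {_< 1 + v} ρ p ℕ.≤-refl (renames-≤ (ℕ.n≤1+n v) ρ<v))
    tracks′ : ∀ f → Tracks (rename ρ p v) (relabel L v f) (relabel L₀ p f)
    tracks′ f = tracks-rename {ρ} {relabel L v f} p v f (relabel-same L v f) (tracks-extend {L = L} (f ∷ []) ρ<v tracks)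

  module PositiveExists {φ : Form} {p : ℕ} (hφ : AllAtoms (_< N) φ) (IHφ : Correct positive φ)
                        (ρ : ℕ → ℕ) (κ v : ℕ) (L₀ : Lab) (κ<v : κ < v) (ρ<v : Renames ρ v)
                        (L : Lab) (tracks : Tracks ρ L L₀) where

    ρ′ : ℕ → ℕ
    ρ′ = rename ρ p (1 + v)

    ρ′<3+v : Renames ρ′ (3 + v)
    ρ′<3+v = rename-preserves {_< 3 + v} ρ p (fresh< v (suc zero)) (renames-≤ (ℕ.m≤n+m v 3) ρ<v)

    o : Output
    o = translate positive ρ′ (2 + v) (3 + v) φ

    IH : ∀ f → Implements positive ρ′ (relabel L₀ p f) (2 + v) φ o
    IH f = IHφ ρ′ (2 + v) (3 + v) (relabel L₀ p f) ℕ.≤-refl ρ′<3+v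

    X : Form
    X = EF (atom v ∧ᶠ atom κ) ⇒ᶠ EF (atom v ∧ᶠ atom (2 + v))

    hX : AllAtoms (_< 3 + v) X
    hX = allAtoms-⇒ (allAtoms-EF (s≤s z≤n) (allAtoms-∧ (atom (fresh< v zero)) (atom (fresh-above 3 κ<v))))
                    (allAtoms-EF (s≤s z≤n) (allAtoms-∧ (atom (fresh< v zero)) (atom (fresh< v (suc (suc zero))))))

    Witness : Marking → Set
    Witness fu = Σ (Vec Marking 2) λ fs → Sat G (extend L v (fu ∷ fs)) X s × Sat G (extend L v (fu ∷ fs)) (formula o) s

    Y : Form
    Y = quantify (fresh∃ (1 + v) 2) (X ∧ᶠ formula o)

    sat-witness : ∀ fu → Sat G (relabel L v fu) Y s ⇔ Witness fu
    sat-witness fu = mk⇔ (λ h → let (fs , h′) = to fresh h in fs , to (sat-∧ X (formula o)) h′)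
                         (λ (fs , x , h) → from fresh (fs , from (sat-∧ X (formula o)) (x , h)))
      where fresh = sat-fresh∃ 2 {relabel L v fu} {1 + v} {X ∧ᶠ formula o}

    sat-witnesses : Sat G L (formula (translate positive ρ κ v (∃ₚ p φ))) s ⇔ (∀ fu → Witness fu)
    sat-witnesses = mk⇔ (λ h fu → to (sat-witness fu) (to (sat-∀ₚ v Y) h fu))
                        (λ W → from (sat-∀ₚ v Y) λ fu → from (sat-witness fu) (W fu))
                    ⇔-∘ sat-node (λ a a<m m≤a → ℕ.<⇒≱ a<m m≤a) (∀q v ∷ fresh∃ (1 + v) 2) X [] o hX
                                 (prefix-above (scoped positive ρ′ (2 + v) (3 + v) φ hφ ℕ.≤-refl ρ′<3+v)) L

    tracks′ : ∀ fu fv fk → Tracks ρ′ (extend L v (fu ∷ fv ∷ fk ∷ [])) (relabel L₀ p fv)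
    tracks′ fu fv fk = tracks-rename {ρ} {extend L v fs} p (1 + v) fv (extend-lookup L v fs (suc zero))
                                     (tracks-extend {L = L} fs ρ<v tracks)
      where fs = fu ∷ fv ∷ fk ∷ []

    single : Fin (Graph.n G) → Marking
    single t t′ = does (t′ Fin.≟ t)

    -- The marker atom v marks exactly t, so the state where the witness was found is t.
    witness-at : ∀ t → Reach s t → Atom L κ t → Witness (single t) → Sat G L₀ (∃ₚ p φ) t
    witness-at t r κt (fv ∷ fk ∷ [] , x , h) =
      let fs = single t ∷ fv ∷ fk ∷ []
          (t′ , r′ , vt′ , kt′) = to (sat-meets {extend L v fs} v κ (2 + v)) x
                                    (t , r , from (atom-extend L v fs zero t r) (dec-true (t Fin.≟ t) refl) ,
                                     from (atom-extend-below L v fs κ<v t r) κt)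
          t′≡t = does-true (t′ Fin.≟ t) (to (atom-extend L v fs zero t′ r′) vt′)
      in fv , subst (Sat G (relabel L₀ p fv) φ) t′≡t (⊑⁺⇒⊆ (to (IH fv _ (tracks′ _ fv fk)) h) t′ r′ kt′)

    Marked : Marking → Set
    Marked fu = ∃ λ t → Reach s t × fu t ≡ true × Atom L κ t

    witness-marked : Atom L κ ⊆⟨ s ⟩ Sat G L₀ (∃ₚ p φ) → ∀ fu → Marked fu → Witness fu
    witness-marked κ⊆∃φ fu (t , r , ut , κt) =
      let (fv , hφ) = κ⊆∃φ t r κt
          L₁ = relabel L₀ p fv
          fs = fu ∷ fv ∷ truth L₁ φ ∷ []
      in fv ∷ truth L₁ φ ∷ [] ,
         from (sat-meets {extend L v fs} v κ (2 + v))
           (λ _ → t , r , from (atom-extend L v fs zero t r) ut ,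
                  from (atom-extend L v fs (suc (suc zero)) t r) (from (does-sat L₁ φ t) hφ)) ,
         from (IH fv _ (tracks′ fu fv _))
              (lower λ t r kt → to (does-sat L₁ φ t) (to (atom-extend L v fs (suc (suc zero)) t r) kt))

    witness-unmarked : ∀ fu → ¬ Marked fu → Witness fu
    witness-unmarked fu ¬m =
      off ∷ off ∷ [] ,
      from (sat-meets {extend L v fs} v κ (2 + v))
        (λ (t , r , vt , κt) →
           ⊥-elim (¬m (t , r , to (atom-extend L v fs zero t r) vt , to (atom-extend-below L v fs κ<v t r) κt))) ,
      from (IH off _ (tracks′ fu off off))
           (lower λ t r kt → contradiction (to (atom-extend L v fs (suc (suc zero)) t r) kt) λ ())
      where
      off : Marking
      off _ = false
      fs = fu ∷ off ∷ off ∷ []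

    witnesses : Atom L κ ⊆⟨ s ⟩ Sat G L₀ (∃ₚ p φ) → ∀ fu → Witness fu
    witnesses κ⊆∃φ fu = to (sat-witness fu) (dne _ Y s λ ¬W →
      ¬W (from (sat-witness fu) (witness-unmarked fu λ m → ¬W (from (sat-witness fu) (witness-marked κ⊆∃φ fu m)))))

  correct-∃⁺ : ∀ {φ p} → AllAtoms (_< N) φ → Correct positive φ → Correct positive (∃ₚ p φ)
  correct-∃⁺ hφ IHφ ρ κ v L₀ κ<v ρ<v L tracks =
    mk⇔ (λ W → lower λ t r κt → witness-at t r κt (W (single t))) (λ { (lower κ⊆∃φ) → witnesses κ⊆∃φ })
      ⇔-∘ sat-witnesses
    where open PositiveExists hφ IHφ ρ κ v L₀ κ<v ρ<v L tracks

  translate-correct : ∀ pol φ → AllAtoms (_< N) φ → Correct pol φ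
  translate-correct pol (atom q) (atom q<N) = correct-atom q<N
  translate-correct pol (neg φ) (neg hφ) = correct-neg hφ (translate-correct (opposite pol) φ hφ)
  translate-correct pol (φ ∨ᶠ ψ) (hφ ∨ᶠ hψ) =
    correct-or hφ hψ (translate-correct pol φ hφ) (translate-correct pol ψ hψ)
  translate-correct pol (EX φ) (EX hφ) = correct-EX hφ (translate-correct pol φ hφ)
  translate-correct pol (EU φ ψ) (EU hφ hψ) =
    correct-until EU EUₚ-mono (λ _ _ → ⇔-id _) (λ pa pb → EU (atom pa) (atom pb))
                  hφ hψ (translate-correct pol φ hφ) (translate-correct pol ψ hψ)
  translate-correct pol (AU φ ψ) (AU hφ hψ) =
    correct-until AU AUₚ-mono (λ _ _ → ⇔-id _) (λ pa pb → AU (atom pa) (atom pb))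
                  hφ hψ (translate-correct pol φ hφ) (translate-correct pol ψ hψ)
  translate-correct positive (∃ₚ p φ) (∃ₚ _ hφ) = correct-∃⁺ hφ (translate-correct positive φ hφ)
  translate-correct negative (∃ₚ p φ) (∃ₚ _ hφ) = correct-∃⁻ (translate-correct negative φ hφ)

-- Shape and size

isBoolAtoms-⊤ : IsBoolAtoms ⊤ᶠ
isBoolAtoms-⊤ = or (atom 0) (neg (atom 0))

isBoolAtoms-∧ : ∀ {A B} → IsBoolAtoms A → IsBoolAtoms B → IsBoolAtoms (A ∧ᶠ B)
isBoolAtoms-∧ a b = neg (or (neg a) (neg b))

isBoolAtoms-guard : ∀ pol {A B} → IsBoolAtoms A → IsBoolAtoms B → IsBoolAtoms (guard pol A B)
isBoolAtoms-guard positive a b = or (neg a) b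
isBoolAtoms-guard negative a b = or (neg b) a

isBoolBasic-AG : ∀ {A} → IsBoolAtoms A → IsBoolBasic (AG A)
isBoolBasic-AG a = neg (basic (eu isBoolAtoms-⊤ (neg a)))

isBoolBasic-∧ : ∀ {A B} → IsBoolBasic A → IsBoolBasic B → IsBoolBasic (A ∧ᶠ B)
isBoolBasic-∧ a b = neg (or (neg a) (neg b))

allBasic-++ : ∀ {D₁ D₂} → AllBasic D₁ → AllBasic D₂ → AllBasic (D₁ ++ D₂)
allBasic-++ [] b₂ = b₂
allBasic-++ (b ∷ b₁) b₂ = b ∷ allBasic-++ b₁ b₂

record Shaped (o : Output) : Set where
  constructor shaped
  field
    base-shaped : IsBoolBasic (base o)
    defs-shaped : AllBasic (defs o)

node-shaped : ∀ vs {X ds o} → IsBoolBasic X → AllBasic ds → Shaped o → Shaped (node vs X ds o)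
node-shaped vs x ds (shaped b d) = shaped (isBoolBasic-∧ x b) (allBasic-++ ds d)

⊗-shaped : ∀ {o₁ o₂} → Shaped o₁ → Shaped o₂ → Shaped (o₁ ⊗ o₂)
⊗-shaped (shaped b₁ d₁) (shaped b₂ d₂) = shaped (isBoolBasic-∧ b₁ b₂) (allBasic-++ d₁ d₂)

universally-shaped : ∀ {v o} → Shaped o → Shaped (universally v o)
universally-shaped (shaped b d) = shaped b d

translate-shaped : ∀ pol ρ κ v φ → Shaped (translate pol ρ κ v φ)
translate-shaped pol ρ κ v (atom q) = shaped (isBoolBasic-AG (isBoolAtoms-guard pol (atom κ) (atom (ρ q)))) []
translate-shaped pol ρ κ v (neg φ) =
  node-shaped (fresh∃ v 1) (isBoolBasic-AG (isBoolAtoms-guard pol (atom κ) (neg (atom v)))) []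
    (translate-shaped (opposite pol) ρ v (1 + v) φ)
translate-shaped pol ρ κ v (φ ∨ᶠ ψ) =
  node-shaped (fresh∃ v 2) (isBoolBasic-AG (isBoolAtoms-guard pol (atom κ) (or (atom v) (atom (1 + v))))) []
    (⊗-shaped (translate-shaped pol ρ v (2 + v) φ)
              (translate-shaped pol ρ (1 + v) (next (translate pol ρ v (2 + v) φ)) ψ))
translate-shaped pol ρ κ v (EX φ) =
  node-shaped (fresh∃ v 2) (isBoolBasic-AG (isBoolAtoms-guard pol (atom κ) (atom (1 + v)))) (ex (atom v) ∷ [])
    (translate-shaped pol ρ v (2 + v) φ)
translate-shaped pol ρ κ v (EU φ ψ) =
  node-shaped (fresh∃ v 3) (isBoolBasic-AG (isBoolAtoms-guard pol (atom κ) (atom (2 + v))))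
    (eu (atom v) (atom (1 + v)) ∷ [])
    (⊗-shaped (translate-shaped pol ρ v (3 + v) φ)
              (translate-shaped pol ρ (1 + v) (next (translate pol ρ v (3 + v) φ)) ψ))
translate-shaped pol ρ κ v (AU φ ψ) =
  node-shaped (fresh∃ v 3) (isBoolBasic-AG (isBoolAtoms-guard pol (atom κ) (atom (2 + v))))
    (au (atom v) (atom (1 + v)) ∷ [])
    (⊗-shaped (translate-shaped pol ρ v (3 + v) φ)
              (translate-shaped pol ρ (1 + v) (next (translate pol ρ v (3 + v) φ)) ψ))
translate-shaped positive ρ κ v (∃ₚ p φ) =
  node-shaped (∀q v ∷ fresh∃ (1 + v) 2)
    (or (neg (basic (eu isBoolAtoms-⊤ (isBoolAtoms-∧ (atom v) (atom κ)))))
        (basic (eu isBoolAtoms-⊤ (isBoolAtoms-∧ (atom v) (atom (2 + v))))))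
    [] (translate-shaped positive (rename ρ p (1 + v)) (2 + v) (3 + v) φ)
translate-shaped negative ρ κ v (∃ₚ p φ) = universally-shaped (translate-shaped negative (rename ρ p v) κ (1 + v) φ)

qsize : List Quant → ℕ
qsize [] = 0
qsize (∃q _ ∷ Q) = 1 + qsize Q
qsize (∀q _ ∷ Q) = 3 + qsize Q

dsize : List (ℕ × Form) → ℕ
dsize [] = 0
dsize ((κ , θ) ∷ D) = 4 + size (AG (atom κ ⇔ᶠ θ)) + dsize D

weight : Output → ℕ
weight o = qsize (prefix o) + size (base o) + dsize (defs o)

size-quantify : ∀ Q X → size (quantify Q X) ≡ qsize Q + size X
size-quantify [] X = refl
size-quantify (∃q p ∷ Q) X = cong suc (size-quantify Q X)
size-quantify (∀q p ∷ Q) X = cong (3 +_) (size-quantify Q X)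

size-conjAG : ∀ C D → size (conjAG C D) ≡ size C + dsize D
size-conjAG C [] = sym (ℕ.+-identityʳ (size C))
size-conjAG C ((κ , θ) ∷ D) rewrite size-conjAG C D = lemma (size C) (dsize D) (size (AG (atom κ ⇔ᶠ θ)))
  where
  lemma : ∀ c d a → suc (suc (suc (c + d + suc a))) ≡ c + (4 + a + d)
  lemma = solve-∀

size-formula : ∀ o → size (formula o) ≡ weight o
size-formula o rewrite size-quantify (prefix o) (conjAG (base o) (defs o)) | size-conjAG (base o) (defs o) =
  sym (ℕ.+-assoc (qsize (prefix o)) (size (base o)) (dsize (defs o)))

qsize-++ : ∀ Q₁ Q₂ → qsize (Q₁ ++ Q₂) ≡ qsize Q₁ + qsize Q₂
qsize-++ [] Q₂ = refl
qsize-++ (∃q p ∷ Q₁) Q₂ = cong suc (qsize-++ Q₁ Q₂)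
qsize-++ (∀q p ∷ Q₁) Q₂ = cong (3 +_) (qsize-++ Q₁ Q₂)

dsize-++ : ∀ D₁ D₂ → dsize (D₁ ++ D₂) ≡ dsize D₁ + dsize D₂
dsize-++ [] D₂ = refl
dsize-++ ((κ , θ) ∷ D₁) D₂ rewrite dsize-++ D₁ D₂ =
  sym (ℕ.+-assoc (4 + size (AG (atom κ ⇔ᶠ θ))) (dsize D₁) (dsize D₂))

local : List Quant → Form → List (ℕ × Form) → ℕ
local vs X ds = qsize vs + size X + dsize ds + 4

weight-node : ∀ vs X ds o → weight (node vs X ds o) ≡ local vs X ds + weight o
weight-node vs X ds o rewrite qsize-++ vs (prefix o) | dsize-++ ds (defs o) =
  lemma (qsize vs) (qsize (prefix o)) (size X) (size (base o)) (dsize ds) (dsize (defs o))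
  where
  lemma : ∀ q q′ x b d d′ → q + q′ + suc (suc (suc (x + suc b))) + (d + d′) ≡ q + x + d + 4 + (q′ + b + d′)
  lemma = solve-∀

weight-⊗ : ∀ o₁ o₂ → weight (o₁ ⊗ o₂) ≡ 4 + weight o₁ + weight o₂
weight-⊗ o₁ o₂ rewrite qsize-++ (prefix o₁) (prefix o₂) | dsize-++ (defs o₁) (defs o₂) =
  lemma (qsize (prefix o₁)) (qsize (prefix o₂)) (size (base o₁)) (size (base o₂)) (dsize (defs o₁)) (dsize (defs o₂))
  where
  lemma : ∀ q q′ b b′ d d′ →
          q + q′ + suc (suc (suc (b + suc b′))) + (d + d′) ≡ 4 + (q + b + d) + (q′ + b′ + d′)
  lemma = solve-∀

size-AG-guard : ∀ pol A B → size (AG (guard pol A B)) ≡ size (AG (A ⇒ᶠ B))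
size-AG-guard positive A B = refl
size-AG-guard negative A B = cong (9 +_) (ℕ.+-comm (size B) (size A))

guarded-local : ∀ pol vs A B ds c {m} →
                c + local vs (AG (A ⇒ᶠ B)) ds ≤ m → c + local vs (AG (guard pol A B)) ds ≤ m
guarded-local pol vs A B ds c {m} = subst (λ z → c + (qsize vs + z + dsize ds + 4) ≤ m) (sym (size-AG-guard pol A B))

-- The local part of a node has at most 49 symbols, a bound attained by the until nodes (counting the
-- conjunction that joins their two children).
module WeightBound (k : ℕ) (49≤k : 49 ≤ k) where
  open ℕ.≤-Reasoning

  node-weight₁ : ∀ vs X ds o {a} → local vs X ds ≤ 49 → weight o ≤ k * a → weight (node vs X ds o) ≤ k * suc a
  node-weight₁ vs X ds o {a} c≤49 w≤ka = begin
    weight (node vs X ds o)   ≡⟨ weight-node vs X ds o ⟩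
    local vs X ds + weight o  ≤⟨ ℕ.+-mono-≤ (ℕ.≤-trans c≤49 49≤k) w≤ka ⟩
    k + k * a                 ≡⟨ ℕ.*-suc k a ⟨
    k * suc a                 ∎

  node-weight₂ : ∀ vs X ds o₁ o₂ {a b} → 4 + local vs X ds ≤ 49 →
                 weight o₁ ≤ k * a → weight o₂ ≤ k * b →
                 weight (node vs X ds (o₁ ⊗ o₂)) ≤ k * suc (a + b)
  node-weight₂ vs X ds o₁ o₂ {a} {b} c≤49 w₁≤ka w₂≤kb = begin
    weight (node vs X ds (o₁ ⊗ o₂))
      ≡⟨ trans (weight-node vs X ds (o₁ ⊗ o₂)) (cong (local vs X ds +_) (weight-⊗ o₁ o₂)) ⟩
    local vs X ds + (4 + weight o₁ + weight o₂)
      ≡⟨ shuffle (local vs X ds) (weight o₁) (weight o₂) ⟩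
    4 + local vs X ds + (weight o₁ + weight o₂)
      ≤⟨ ℕ.+-mono-≤ (ℕ.≤-trans c≤49 49≤k) (ℕ.+-mono-≤ w₁≤ka w₂≤kb) ⟩
    k + (k * a + k * b)
      ≡⟨ distrib k a b ⟩
    k * suc (a + b)
      ∎
    where
    shuffle : ∀ c w₁ w₂ → c + (4 + w₁ + w₂) ≡ 4 + c + (w₁ + w₂)
    shuffle = solve-∀
    distrib : ∀ k a b → k + (k * a + k * b) ≡ k * suc (a + b)
    distrib = solve-∀

  translate-weight : ∀ pol ρ κ v φ → weight (translate pol ρ κ v φ) ≤ k * size φ
  translate-weight pol ρ κ v (atom q) =
    ℕ.≤-trans (ℕ.m≤m+n _ 4) (ℕ.≤-trans (guarded-local pol [] (atom κ) (atom (ρ q)) [] 0 (ℕ.≤ᵇ⇒≤ _ 49 _))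
                                       (ℕ.≤-trans 49≤k (ℕ.m≤m*n k 1)))
  translate-weight pol ρ κ v (neg φ) =
    node-weight₁ (fresh∃ v 1) (AG (guard pol (atom κ) (neg (atom v)))) [] (translate (opposite pol) ρ v (1 + v) φ)
      (guarded-local pol (fresh∃ v 1) (atom κ) (neg (atom v)) [] 0 (ℕ.≤ᵇ⇒≤ _ 49 _))
      (translate-weight (opposite pol) ρ v (1 + v) φ)
  translate-weight pol ρ κ v (φ ∨ᶠ ψ) =
    node-weight₂ (fresh∃ v 2) (AG (guard pol (atom κ) (atom v ∨ᶠ atom (1 + v)))) []
                 o₁ (translate pol ρ (1 + v) (next o₁) ψ)
      (guarded-local pol (fresh∃ v 2) (atom κ) (atom v ∨ᶠ atom (1 + v)) [] 4 (ℕ.≤ᵇ⇒≤ _ 49 _))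
      (translate-weight pol ρ v (2 + v) φ) (translate-weight pol ρ (1 + v) (next o₁) ψ)
    where o₁ = translate pol ρ v (2 + v) φ
  translate-weight pol ρ κ v (EX φ) =
    node-weight₁ (fresh∃ v 2) (AG (guard pol (atom κ) (atom (1 + v)))) ds (translate pol ρ v (2 + v) φ)
      (guarded-local pol (fresh∃ v 2) (atom κ) (atom (1 + v)) ds 0 (ℕ.≤ᵇ⇒≤ _ 49 _))
      (translate-weight pol ρ v (2 + v) φ)
    where ds = (1 + v , EX (atom v)) ∷ []
  translate-weight pol ρ κ v (EU φ ψ) =
    node-weight₂ (fresh∃ v 3) (AG (guard pol (atom κ) (atom (2 + v)))) ds o₁ (translate pol ρ (1 + v) (next o₁) ψ)
      (guarded-local pol (fresh∃ v 3) (atom κ) (atom (2 + v)) ds 4 (ℕ.≤ᵇ⇒≤ _ 49 _))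
      (translate-weight pol ρ v (3 + v) φ) (translate-weight pol ρ (1 + v) (next o₁) ψ)
    where
    o₁ = translate pol ρ v (3 + v) φ
    ds = (2 + v , EU (atom v) (atom (1 + v))) ∷ []
  translate-weight pol ρ κ v (AU φ ψ) =
    node-weight₂ (fresh∃ v 3) (AG (guard pol (atom κ) (atom (2 + v)))) ds o₁ (translate pol ρ (1 + v) (next o₁) ψ)
      (guarded-local pol (fresh∃ v 3) (atom κ) (atom (2 + v)) ds 4 (ℕ.≤ᵇ⇒≤ _ 49 _))
      (translate-weight pol ρ v (3 + v) φ) (translate-weight pol ρ (1 + v) (next o₁) ψ)
    where
    o₁ = translate pol ρ v (3 + v) φ
    ds = (2 + v , AU (atom v) (atom (1 + v))) ∷ []
  translate-weight positive ρ κ v (∃ₚ p φ) =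
    node-weight₁ (∀q v ∷ fresh∃ (1 + v) 2) (EF (atom v ∧ᶠ atom κ) ⇒ᶠ EF (atom v ∧ᶠ atom (2 + v))) []
      (translate positive (rename ρ p (1 + v)) (2 + v) (3 + v) φ) (ℕ.≤ᵇ⇒≤ _ 49 _)
      (translate-weight positive (rename ρ p (1 + v)) (2 + v) (3 + v) φ)
  translate-weight negative ρ κ v (∃ₚ p φ) = begin
    3 + weight (translate negative (rename ρ p v) κ (1 + v) φ)
      ≤⟨ ℕ.+-mono-≤ (ℕ.≤-trans (ℕ.≤ᵇ⇒≤ 3 49 _) 49≤k)
                    (translate-weight negative (rename ρ p v) κ (1 + v) φ) ⟩
    k + k * size φ
      ≡⟨ ℕ.*-suc k (size φ) ⟨
    k * suc (size φ)
      ∎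

-- The flattening

maxAtom : Form → ℕ
maxAtom (atom q) = q
maxAtom (neg φ) = maxAtom φ
maxAtom (φ ∨ᶠ ψ) = maxAtom φ ⊔ maxAtom ψ
maxAtom (EX φ) = maxAtom φ
maxAtom (EU φ ψ) = maxAtom φ ⊔ maxAtom ψ
maxAtom (AU φ ψ) = maxAtom φ ⊔ maxAtom ψ
maxAtom (∃ₚ p φ) = p ⊔ maxAtom φ

allAtoms-≤-mono : ∀ {m m′ φ} → m ≤ m′ → AllAtoms (_≤ m) φ → AllAtoms (_≤ m′) φ
allAtoms-≤-mono m≤m′ = allAtoms-mono (λ a≤m → ℕ.≤-trans a≤m m≤m′)

allAtoms-≤-max : ∀ φ → AllAtoms (_≤ maxAtom φ) φ
allAtoms-≤-max (atom q) = atom ℕ.≤-refl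
allAtoms-≤-max (neg φ) = neg (allAtoms-≤-max φ)
allAtoms-≤-max (φ ∨ᶠ ψ) =
  allAtoms-≤-mono (ℕ.m≤m⊔n _ _) (allAtoms-≤-max φ) ∨ᶠ allAtoms-≤-mono (ℕ.m≤n⊔m _ _) (allAtoms-≤-max ψ)
allAtoms-≤-max (EX φ) = EX (allAtoms-≤-max φ)
allAtoms-≤-max (EU φ ψ) =
  EU (allAtoms-≤-mono (ℕ.m≤m⊔n _ _) (allAtoms-≤-max φ)) (allAtoms-≤-mono (ℕ.m≤n⊔m _ _) (allAtoms-≤-max ψ))
allAtoms-≤-max (AU φ ψ) =
  AU (allAtoms-≤-mono (ℕ.m≤m⊔n _ _) (allAtoms-≤-max φ)) (allAtoms-≤-mono (ℕ.m≤n⊔m _ _) (allAtoms-≤-max ψ))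
allAtoms-≤-max (∃ₚ p φ) = ∃ₚ (ℕ.m≤m⊔n p _) (allAtoms-≤-mono (ℕ.m≤n⊔m p _) (allAtoms-≤-max φ))

-- E ⊥ U κ is the basic formula saying that κ holds now.
flatten : Form → Output
flatten Φ = node (fresh∃ κ 1) (EU (neg ⊤ᶠ) (atom κ)) [] (translate positive (λ q → q) κ (suc κ) Φ)
  where κ = suc (maxAtom Φ)

Flat₁ : Form → Form
Flat₁ Φ = formula (flatten Φ)

flatten-flat : ∀ Φ → FlatForm (Flat₁ Φ)
flatten-flat Φ =
  prefix (flatten Φ) , base (flatten Φ) , defs (flatten Φ) , refl , Shaped.base-shaped sh , Shaped.defs-shaped sh
  where
  κ = suc (maxAtom Φ)
  sh : Shaped (flatten Φ)
  sh = node-shaped (fresh∃ κ 1) (basic (eu (neg isBoolAtoms-⊤) (atom κ))) []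
                   (translate-shaped positive (λ q → q) κ (suc κ) Φ)

size-positive : ∀ φ → 1 ≤ size φ
size-positive (atom _) = s≤s z≤n
size-positive (neg _) = s≤s z≤n
size-positive (_ ∨ᶠ _) = s≤s z≤n
size-positive (EX _) = s≤s z≤n
size-positive (EU _ _) = s≤s z≤n
size-positive (AU _ _) = s≤s z≤n
size-positive (∃ₚ _ _) = s≤s z≤n

flatten-size : ∀ Φ → size (Flat₁ Φ) ≤ 98 * size Φ
flatten-size Φ = begin
  size (Flat₁ Φ)            ≡⟨ size-formula (flatten Φ) ⟩
  weight (flatten Φ)        ≤⟨ node-weight₁ (fresh∃ κ 1) (EU (neg ⊤ᶠ) (atom κ)) [] o (ℕ.≤ᵇ⇒≤ _ 49 _)
                                            (translate-weight positive (λ q → q) κ (suc κ) Φ) ⟩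
  49 * suc (size Φ)         ≡⟨ ℕ.*-suc 49 (size Φ) ⟩
  49 + 49 * size Φ          ≤⟨ ℕ.+-monoˡ-≤ (49 * size Φ) (ℕ.*-monoʳ-≤ 49 (size-positive Φ)) ⟩
  49 * size Φ + 49 * size Φ ≡⟨ ℕ.*-distribʳ-+ (size Φ) 49 49 ⟨
  98 * size Φ               ∎
  where
  open ℕ.≤-Reasoning
  open WeightBound 49 ℕ.≤-refl
  κ = suc (maxAtom Φ)
  o = translate positive (λ q → q) κ (suc κ) Φ

module Flattening (G : Graph) (s : Fin (Graph.n G)) (Φ : Form) where
  open Semantics G

  κ : ℕ
  κ = suc (maxAtom Φ)

  open Correctness κ G s

  flatten-sound : ∀ L → Sat G L (Flat₁ Φ) s ⇔ Sat G L Φ s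
  flatten-sound L = mk⇔ to′ from′ ⇔-∘ sat-node∃ 1 (EU (neg ⊤ᶠ) (atom κ)) [] o hX vo L
    where
    o = translate positive (λ q → q) κ (suc κ) Φ
    hΦ : AllAtoms (_< κ) Φ
    hΦ = allAtoms-mono s≤s (allAtoms-≤-max Φ)
    ρ< : Renames (λ q → q) (suc κ)
    ρ< q q<κ = ℕ.m<n⇒m<1+n q<κ
    vo = prefix-above (scoped positive (λ q → q) κ (suc κ) Φ hΦ ℕ.≤-refl ρ<)
    hX : AllAtoms (_< 1 + κ) (EU (neg ⊤ᶠ) (atom κ))
    hX = EU (neg (atom (s≤s z≤n) ∨ᶠ neg (atom (s≤s z≤n)))) (atom ℕ.≤-refl)
    tracks : ∀ fs → Tracks (λ q → q) (extend L κ fs) L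
    tracks fs q q<κ t = extend-below L fs t q<κ
    IH : Implements positive (λ q → q) L κ Φ o
    IH = translate-correct positive Φ hΦ (λ q → q) κ (suc κ) L ℕ.≤-refl ρ<
    to′ : _ → Sat G L Φ s
    to′ (fs , now , h) = ⊑⁺⇒⊆ (to (IH _ (tracks fs)) h) s ε (to (sat-now {extend L κ fs} (atom κ)) now)
    from′ : Sat G L Φ s → _
    from′ hΦs = fs , from (sat-now {extend L κ fs} (atom κ)) (from (κ≐Φ s ε) hΦs) ,
                from (IH _ (tracks fs)) (≐⇒⊑ positive κ≐Φ)
      where
      fs = truth L Φ ∷ []
      κ≐Φ : Atom (extend L κ fs) κ ≐ Sat G L Φ
      κ≐Φ t r = does-sat L Φ t ⇔-∘ atom-extend L κ fs zero t r

flatten-equivalent : ∀ Φ → Φ ≣ Flat₁ Φ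
flatten-equivalent Φ K s = from e , to e
  where e = Flattening.flatten-sound (Kripke.graph K) s Φ (Kripke.L K)

proposition4 : Σ (Form → Form) λ Flat₁ → Σ ℕ λ c →
    ∀ Φ → FlatForm (Flat₁ Φ) × (Φ ≣ Flat₁ Φ) × (size (Flat₁ Φ) ≤ c * size Φ)
proposition4 = Flat₁ , 98 , λ Φ → flatten-flat Φ , flatten-equivalent Φ , flatten-size Φ
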